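{- For integers $n\ge 1$ and $e\ge 0$, let $H_n(e)$ denote the number of $n\times n$ binary matrices with all diagonal entries equal to $1$, exactly $e$ off-diagonal entries equal to $1$, and permanent equal to $1$. Define $$Z(z,t)=\sum_{k=0}^{\infty}\frac{z^{k}}{k!\,(1+t)^{\binom{k}{2}}},\qquad Y_n(t)=(1+t)^{\binom{n}{2}}\left.\left[\frac{\partial^{n}}{\partial z^{n}}\left(\frac{1}{Z(-z,t)}\right)\right]\right|_{z=0}.$$ Then $$H_n(e)=\frac{1}{e!}\left.\frac{d^{e}Y_n(t)}{dt^{e}}\right|_{t=0}.$$
   Context: A binary matrix has entries in $\{0,1\}$; the permanent of $A=(a_{kl})$ is $\sum_{\sigma\in\mathfrak{S}_n}\prod_{k=1}^n a_{\sigma(k)k}$. $\binom{k}{2}=k(k-1)/2$. The series $Z(-z,t)$ may be regarded as a power series in $z$ with constant term $1$ whose coefficients are rational functions of $t$, so $1/Z(-z,t)$ is defined as a power series in $z$. -}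

module Defs where

open import Data.Bool using (Bool; true; false; if_then_else_; _∧_)
open import Data.Nat using (ℕ; zero; suc; _!; _≡ᵇ_)
open import Data.Nat.Properties using (_!≢0)
open import Data.Nat.Combinatorics using (_C_)
open import Data.Fin using (Fin; _≟_)
open import Data.List using (List; []; _∷_; map; concatMap; filterᵇ; length; allFin)
open import Data.Nat.ListAction using (sum; product)
open import Data.Bool.ListAction using (and)
open import Data.Vec using (Vec; []; _∷_; lookup; toList; head)
import Data.Vec as V
open import Data.List.Relation.Unary.Unique.DecPropositional using (unique?)
open import Relation.Nullary.Decidable using (⌊_⌋; does)
open import Data.Integer using (+_)
open import Data.Rational using (ℚ; 0ℚ; 1ℚ; _+_; _*_; -_; _/_)

allVecs : {A : Set} → (n : ℕ) → List A → List (Vec A n)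
allVecs zero    xs = [] ∷ []
allVecs (suc n) xs = concatMap (λ x → map (x ∷_) (allVecs n xs)) xs

Matrix : ℕ → Set
Matrix n = Vec (Vec Bool n) n

entry : {n : ℕ} → Matrix n → Fin n → Fin n → Bool
entry M k l = lookup (lookup M k) l

allMatrices : (n : ℕ) → List (Matrix n)
allMatrices n = allVecs n (allVecs n (true ∷ false ∷ []))

b2n : Bool → ℕ
b2n true  = 1
b2n false = 0

-- permutations of Fin n, as the injective maps Fin n → Fin n
-- (σ represented by the vector (σ 0, …, σ (n-1)))
permutations : (n : ℕ) → List (Vec (Fin n) n)
permutations n = filterᵇ (λ σ → does (unique? _≟_ (toList σ))) (allVecs n (allFin n))

permanent : {n : ℕ} → Matrix n → ℕ
permanent {n} M =
  sum (map (λ σ → product (map (λ k → b2n (entry M (lookup σ k) k)) (allFin n)))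
           (permutations n))

diagonalAllOne : {n : ℕ} → Matrix n → Bool
diagonalAllOne {n} M = and (map (λ k → entry M k k) (allFin n))

offDiagOnes : {n : ℕ} → Matrix n → ℕ
offDiagOnes {n} M =
  sum (map (λ k → sum (map (λ l → if does (k ≟ l) then 0 else b2n (entry M k l))
                           (allFin n)))
           (allFin n))

H : ℕ → ℕ → ℕ
H n e = length (filterᵇ
  (λ M → diagonalAllOne M ∧ (offDiagOnes M ≡ᵇ e) ∧ (permanent M ≡ᵇ 1))
  (allMatrices n))

-- Analytic side, via formal power series.
-- PS = formal power series in t over ℚ : coefficient of t^j.

PS : Set
PS = ℕ → ℚ

sumFin : (n : ℕ) → (Fin n → ℚ) → ℚ
sumFin zero    f = 0ℚ
sumFin (suc n) f = f Fin.zero + sumFin n (λ i → f (Fin.suc i))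

sumUpTo : ℕ → (ℕ → ℚ) → ℚ
sumUpTo zero    f = f 0
sumUpTo (suc n) f = sumUpTo n f + f (suc n)

_⊕_ : PS → PS → PS
(f ⊕ g) j = f j + g j

_⊛_ : PS → PS → PS
(f ⊛ g) n = sumUpTo n (λ i → f i * g (n Data.Nat.∸ i))

negPS : PS → PS
negPS f j = - f j

scalePS : ℚ → PS → PS
scalePS c f j = c * f j

onePS : PS
onePS zero    = 1ℚ
onePS (suc _) = 0ℚ

_^ₚ_ : PS → ℕ → PS
f ^ₚ zero  = onePS
f ^ₚ suc k = f ⊛ (f ^ₚ k)

onePlusT : PS
onePlusT zero          = 1ℚ
onePlusT (suc zero)    = 1ℚ
onePlusT (suc (suc _)) = 0ℚ

sgn : ℕ → ℚ
sgn zero    = 1ℚ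
sgn (suc k) = - sgn k

-- 1/(1+t) = Σ_j (-1)^j t^j
invOnePlusT : PS
invOnePlusT j = sgn j

-- Z(-z,t) = Σ_k (-1)^k z^k / (k! (1+t)^{C(k,2)}) ;  coefficient of z^k
Zneg : ℕ → PS
Zneg k = scalePS (sgn k * ((+ 1) / (k !)) {{k !≢0}}) (invOnePlusT ^ₚ (k C 2))

-- Reciprocal of a power series in z (coefficients in PS) whose constant
-- term is 1: b_0 = 1, b_n = - Σ_{k=1}^{n} f_k b_{n-k}.
-- invVec f n = (b_n , b_{n-1} , … , b_0)
invVec : (ℕ → PS) → (n : ℕ) → Vec PS (suc n)
invVec f zero    = onePS ∷ []
invVec f (suc n) =
  negPS (λ j → sumFin (suc n) (λ i → (f (suc (Data.Fin.toℕ i)) ⊛ lookup prev i) j)) ∷ prev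
  where prev = invVec f n

invZnegCoeff : ℕ → PS
invZnegCoeff n = head (invVec Zneg n)

-- Y_n(t) = (1+t)^{C(n,2)} · [∂^n/∂z^n (1/Z(-z,t))]_{z=0}
--        = (1+t)^{C(n,2)} · n! · [z^n] (1/Z(-z,t))
Y : ℕ → PS
Y n = (onePlusT ^ₚ (n C 2)) ⊛ scalePS ((+ (n !)) / 1) (invZnegCoeff n)

-- (1/e!) d^e/dt^e F(t) |_{t=0} = coefficient of t^e of (the Taylor series of) F
taylorCoeff : PS → ℕ → ℚ
taylorCoeff F e = F e

ℕtoℚ : ℕ → ℚ
ℕtoℚ m = (+ m) / 1

module Submission where

open import Defs
open import Data.Nat using (ℕ; _≤_)
open import Relation.Binary.PropositionalEquality using (_≡_; trans; sym)

-- For each n both sides are coefficients of a power series in t: the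
-- combinatorial series HPS n = Σ_e H n e · tᵉ and the analytic series Y n.  Both
-- families X satisfy X 0 = 1 and, for N ≥ 1, the recurrence
--     Σ_{s=0}^{N} (-1)ˢ C(N,s) (1+t)^{s(N-s)} X(N-s) = 0,
-- whose s = 0 term is X N itself; hence the two families coincide (Rec-unique).
-- Analytic side: multiplying Σ_k [zᵏ]Z(-z,t) · [z^{N-k}](1/Z(-z,t)) = 0 by
-- N!(1+t)^{C(N,2)} gives the recurrence, since C(N,2) = C(s,2) + C(N-s,2) + s(N-s).
-- Combinatorial side: with unit diagonal, permanent 1 means that the identity is the
-- only supported permutation.  The matrices in which all vertices of a set S are sinks
-- (columns empty off the diagonal) have total weight (1+t)^{|S|(N-|S|)} · HPS (N-|S|),
-- by removing the sinks one at a time; inclusion–exclusion over S gives the recurrence,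
-- because a nonempty such matrix always has a sink.

module PowerSeries where

  open import Data.Nat as ℕ using (zero; suc; _∸_; z≤n)
  import Data.Nat.Properties as ℕP
  open import Data.Rational using (ℚ; 0ℚ; 1ℚ; _+_; _*_; -_)
  open import Data.Rational.Properties
  open import Algebra.Bundles using (CommutativeMonoid)
  open import Algebra.Properties.CommutativeSemigroup
    (CommutativeMonoid.commutativeSemigroup +-0-commutativeMonoid) using (interchange)
  open import Relation.Binary.PropositionalEquality
  open ≡-Reasoning

  _≗ₚ_ : PS → PS → Set
  f ≗ₚ g = ∀ j → f j ≡ g j
  infix 4 _≗ₚ_

  sumUpTo-cong : ∀ n {f g : ℕ → ℚ} → (∀ i → i ℕ.≤ n → f i ≡ g i) → sumUpTo n f ≡ sumUpTo n g
  sumUpTo-cong zero eq = eq 0 z≤n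
  sumUpTo-cong (suc n) eq = cong₂ _+_ (sumUpTo-cong n (λ i i≤n → eq i (ℕP.m≤n⇒m≤1+n i≤n))) (eq (suc n) ℕP.≤-refl)

  sumUpTo-+ : ∀ n (f g : ℕ → ℚ) → sumUpTo n (λ i → f i + g i) ≡ sumUpTo n f + sumUpTo n g
  sumUpTo-+ zero f g = refl
  sumUpTo-+ (suc n) f g = trans (cong (_+ (f (suc n) + g (suc n))) (sumUpTo-+ n f g)) (interchange (sumUpTo n f) (sumUpTo n g) (f (suc n)) (g (suc n)))

  sumUpTo-*ˡ : ∀ n c (f : ℕ → ℚ) → c * sumUpTo n f ≡ sumUpTo n (λ i → c * f i)
  sumUpTo-*ˡ zero c f = refl
  sumUpTo-*ˡ (suc n) c f = trans (*-distribˡ-+ c _ _) (cong (_+ (c * f (suc n))) (sumUpTo-*ˡ n c f))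

  sumUpTo-*ʳ : ∀ n c (f : ℕ → ℚ) → sumUpTo n f * c ≡ sumUpTo n (λ i → f i * c)
  sumUpTo-*ʳ n c f = trans (*-comm _ c) (trans (sumUpTo-*ˡ n c f) (sumUpTo-cong n (λ i _ → *-comm c (f i))))

  sumUpTo-0 : ∀ n → sumUpTo n (λ _ → 0ℚ) ≡ 0ℚ
  sumUpTo-0 zero = refl
  sumUpTo-0 (suc n) = trans (cong (_+ 0ℚ) (sumUpTo-0 n)) refl

  sumUpTo-shift : ∀ n (f : ℕ → ℚ) → sumUpTo (suc n) f ≡ f 0 + sumUpTo n (λ i → f (suc i))
  sumUpTo-shift zero f = refl
  sumUpTo-shift (suc n) f = begin
    sumUpTo (suc n) f + f (suc (suc n)) ≡⟨ cong (_+ f (suc (suc n))) (sumUpTo-shift n f) ⟩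
    (f 0 + sumUpTo n (λ i → f (suc i))) + f (suc (suc n)) ≡⟨ +-assoc (f 0) (sumUpTo n (λ i → f (suc i))) (f (suc (suc n))) ⟩
    f 0 + sumUpTo (suc n) (λ i → f (suc i)) ∎

  sumUpTo-rev : ∀ n (f : ℕ → ℚ) → sumUpTo n f ≡ sumUpTo n (λ i → f (n ∸ i))
  sumUpTo-rev zero f = refl
  sumUpTo-rev (suc n) f = begin
    sumUpTo n f + f (suc n) ≡⟨ cong (_+ f (suc n)) (sumUpTo-rev n f) ⟩
    sumUpTo n (λ i → f (n ∸ i)) + f (suc n) ≡⟨ +-comm (sumUpTo n (λ i → f (n ∸ i))) (f (suc n)) ⟩
    f (suc n) + sumUpTo n (λ i → f (n ∸ i)) ≡⟨ sym (sumUpTo-shift n (λ i → f (suc n ∸ i))) ⟩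
    sumUpTo (suc n) (λ i → f (suc n ∸ i)) ∎

  sumUpTo-triangle : ∀ n (F : ℕ → ℕ → ℚ) →
    sumUpTo n (λ i → sumUpTo i (λ k → F k (i ∸ k))) ≡ sumUpTo n (λ k → sumUpTo (n ∸ k) (λ m → F k m))
  sumUpTo-triangle zero F = refl
  sumUpTo-triangle (suc n) F = begin
    sumUpTo n (λ i → sumUpTo i (λ k → F k (i ∸ k))) + sumUpTo (suc n) (λ k → F k (suc n ∸ k))
      ≡⟨ cong (_+ sumUpTo (suc n) (λ k → F k (suc n ∸ k))) (sumUpTo-triangle n F) ⟩
    R + (sumUpTo n (λ k → F k (suc n ∸ k)) + F (suc n) (n ∸ n))
      ≡⟨ sym (+-assoc R _ _) ⟩
    (R + sumUpTo n (λ k → F k (suc n ∸ k))) + F (suc n) (n ∸ n)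
      ≡⟨ cong (_+ F (suc n) (n ∸ n)) (sym (sumUpTo-+ n _ _)) ⟩
    sumUpTo n (λ k → sumUpTo (n ∸ k) (F k) + F k (suc n ∸ k)) + F (suc n) (n ∸ n)
      ≡⟨ cong₂ _+_ (sumUpTo-cong n (λ k k≤n → extendRow k k≤n)) lastRow ⟩
    sumUpTo (suc n) (λ k → sumUpTo (suc n ∸ k) (F k)) ∎
    where
    R : ℚ
    R = sumUpTo n (λ k → sumUpTo (n ∸ k) (λ m → F k m))
    extendRow : ∀ k → k ℕ.≤ n → sumUpTo (n ∸ k) (F k) + F k (suc n ∸ k) ≡ sumUpTo (suc n ∸ k) (F k)
    extendRow k k≤n = trans (cong (λ x → sumUpTo (n ∸ k) (F k) + F k x) (ℕP.+-∸-assoc 1 k≤n))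
                            (cong (λ x → sumUpTo x (F k)) (sym (ℕP.+-∸-assoc 1 k≤n)))
    lastRow : F (suc n) (n ∸ n) ≡ sumUpTo (suc n ∸ suc n) (F (suc n))
    lastRow = trans (cong (F (suc n)) (ℕP.n∸n≡0 n)) (cong (λ x → sumUpTo x (F (suc n))) (sym (ℕP.n∸n≡0 n)))

  ⊛-cong : ∀ {f f' g g'} → f ≗ₚ f' → g ≗ₚ g' → (f ⊛ g) ≗ₚ (f' ⊛ g')
  ⊛-cong ef eg n = sumUpTo-cong n (λ i _ → cong₂ _*_ (ef i) (eg (n ∸ i)))

  ⊛-congˡ : ∀ {f f'} g → f ≗ₚ f' → (f ⊛ g) ≗ₚ (f' ⊛ g)
  ⊛-congˡ g ef = ⊛-cong {g = g} {g' = g} ef (λ _ → refl)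

  ⊛-congʳ : ∀ f {g g'} → g ≗ₚ g' → (f ⊛ g) ≗ₚ (f ⊛ g')
  ⊛-congʳ f eg = ⊛-cong {f = f} {f' = f} (λ _ → refl) eg

  ⊛-comm : ∀ f g → (f ⊛ g) ≗ₚ (g ⊛ f)
  ⊛-comm f g n = begin
    sumUpTo n (λ i → f i * g (n ∸ i)) ≡⟨ sumUpTo-rev n _ ⟩
    sumUpTo n (λ i → f (n ∸ i) * g (n ∸ (n ∸ i))) ≡⟨ sumUpTo-cong n (λ i i≤n →
       trans (cong (λ x → f (n ∸ i) * g x) (ℕP.m∸[m∸n]≡n i≤n)) (*-comm (f (n ∸ i)) (g i))) ⟩
    sumUpTo n (λ i → g i * f (n ∸ i)) ∎

  ⊛-assoc : ∀ f g h → ((f ⊛ g) ⊛ h) ≗ₚ (f ⊛ (g ⊛ h))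
  ⊛-assoc f g h n = begin
    sumUpTo n (λ i → sumUpTo i (λ k → f k * g (i ∸ k)) * h (n ∸ i))
      ≡⟨ sumUpTo-cong n (λ i _ → sumUpTo-*ʳ i (h (n ∸ i)) (λ k → f k * g (i ∸ k))) ⟩
    sumUpTo n (λ i → sumUpTo i (λ k → f k * g (i ∸ k) * h (n ∸ i)))
      ≡⟨ sumUpTo-cong n (λ i i≤n → sumUpTo-cong i (λ k k≤i →
           cong (λ x → f k * g (i ∸ k) * h x) (reindex i k i≤n k≤i))) ⟩
    sumUpTo n (λ i → sumUpTo i (λ k → f k * g (i ∸ k) * h ((n ∸ k) ∸ (i ∸ k))))
      ≡⟨ sumUpTo-triangle n (λ k m → f k * g m * h ((n ∸ k) ∸ m)) ⟩
    sumUpTo n (λ k → sumUpTo (n ∸ k) (λ m → f k * g m * h ((n ∸ k) ∸ m)))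
      ≡⟨ sumUpTo-cong n (λ k _ → trans (sumUpTo-cong (n ∸ k) (λ m _ → *-assoc (f k) (g m) (h ((n ∸ k) ∸ m))))
                                       (sym (sumUpTo-*ˡ (n ∸ k) (f k) (λ m → g m * h ((n ∸ k) ∸ m))))) ⟩
    sumUpTo n (λ k → f k * sumUpTo (n ∸ k) (λ m → g m * h ((n ∸ k) ∸ m))) ∎
    where
    reindex : ∀ i k → i ℕ.≤ n → k ℕ.≤ i → n ∸ i ≡ (n ∸ k) ∸ (i ∸ k)
    reindex i k i≤n k≤i = begin
      n ∸ i ≡⟨ cong (_∸ i) (sym (ℕP.m+[n∸m]≡n (ℕP.≤-trans k≤i i≤n))) ⟩
      (k ℕ.+ (n ∸ k)) ∸ i ≡⟨ cong ((k ℕ.+ (n ∸ k)) ∸_) (sym (ℕP.m+[n∸m]≡n k≤i)) ⟩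
      (k ℕ.+ (n ∸ k)) ∸ (k ℕ.+ (i ∸ k)) ≡⟨ ℕP.[m+n]∸[m+o]≡n∸o k (n ∸ k) (i ∸ k) ⟩
      (n ∸ k) ∸ (i ∸ k) ∎

  ⊛-distribʳ : ∀ f g h → ((f ⊕ g) ⊛ h) ≗ₚ ((f ⊛ h) ⊕ (g ⊛ h))
  ⊛-distribʳ f g h n = trans (sumUpTo-cong n (λ i _ → *-distribʳ-+ (h (n ∸ i)) (f i) (g i))) (sumUpTo-+ n _ _)

  ⊛-distribˡ : ∀ f g h → (h ⊛ (f ⊕ g)) ≗ₚ ((h ⊛ f) ⊕ (h ⊛ g))
  ⊛-distribˡ f g h n = trans (sumUpTo-cong n (λ i _ → *-distribˡ-+ (h i) (f (n ∸ i)) (g (n ∸ i)))) (sumUpTo-+ n _ _)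

  ⊛-identityˡ : ∀ f → (onePS ⊛ f) ≗ₚ f
  ⊛-identityˡ f zero = *-identityˡ (f 0)
  ⊛-identityˡ f (suc n) = begin
    sumUpTo (suc n) (λ i → onePS i * f (suc n ∸ i)) ≡⟨ sumUpTo-shift n (λ i → onePS i * f (suc n ∸ i)) ⟩
    1ℚ * f (suc n) + sumUpTo n (λ i → 0ℚ * f (n ∸ i))
      ≡⟨ cong₂ _+_ (*-identityˡ (f (suc n))) (trans (sumUpTo-cong n (λ i _ → *-zeroˡ (f (n ∸ i)))) (sumUpTo-0 n)) ⟩
    f (suc n) + 0ℚ ≡⟨ +-identityʳ _ ⟩
    f (suc n) ∎

  scale-⊛ˡ : ∀ c f g → (scalePS c f ⊛ g) ≗ₚ scalePS c (f ⊛ g)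
  scale-⊛ˡ c f g n = trans (sumUpTo-cong n (λ i _ → *-assoc c (f i) _)) (sym (sumUpTo-*ˡ n c _))

  scale-⊛ʳ : ∀ c f g → (f ⊛ scalePS c g) ≗ₚ scalePS c (f ⊛ g)
  scale-⊛ʳ c f g n = trans (⊛-comm f (scalePS c g) n) (trans (scale-⊛ˡ c g f n) (cong (c *_) (⊛-comm g f n)))

  ^ₚ-+ : ∀ f a b → (f ^ₚ (a ℕ.+ b)) ≗ₚ ((f ^ₚ a) ⊛ (f ^ₚ b))
  ^ₚ-+ f zero b n = sym (⊛-identityˡ (f ^ₚ b) n)
  ^ₚ-+ f (suc a) b n = trans (⊛-congʳ f (^ₚ-+ f a b) n) (sym (⊛-assoc f (f ^ₚ a) (f ^ₚ b) n))

  ^ₚ-cong : ∀ {f g} a → f ≗ₚ g → (f ^ₚ a) ≗ₚ (g ^ₚ a)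
  ^ₚ-cong zero e n = refl
  ^ₚ-cong (suc a) e = ⊛-cong e (^ₚ-cong a e)

  ⊛-^ₚ : ∀ f g a → ((f ⊛ g) ^ₚ a) ≗ₚ ((f ^ₚ a) ⊛ (g ^ₚ a))
  ⊛-^ₚ f g zero n = sym (⊛-identityˡ onePS n)
  ⊛-^ₚ f g (suc a) n = begin
    ((f ⊛ g) ⊛ ((f ⊛ g) ^ₚ a)) n ≡⟨ ⊛-congʳ (f ⊛ g) (⊛-^ₚ f g a) n ⟩
    ((f ⊛ g) ⊛ (fa ⊛ ga)) n ≡⟨ ⊛-assoc f g (fa ⊛ ga) n ⟩
    (f ⊛ (g ⊛ (fa ⊛ ga))) n ≡⟨ ⊛-congʳ f middle n ⟩
    (f ⊛ (fa ⊛ (g ⊛ ga))) n ≡⟨ sym (⊛-assoc f fa (g ⊛ ga) n) ⟩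
    ((f ⊛ fa) ⊛ (g ⊛ ga)) n ∎
    where
    fa ga : PS
    fa = f ^ₚ a
    ga = g ^ₚ a
    middle : (g ⊛ (fa ⊛ ga)) ≗ₚ (fa ⊛ (g ⊛ ga))
    middle m = trans (sym (⊛-assoc g fa ga m)) (trans (⊛-congˡ ga (⊛-comm g fa) m) (⊛-assoc fa g ga m))

  onePS-^ : ∀ a → (onePS ^ₚ a) ≗ₚ onePS
  onePS-^ zero n = refl
  onePS-^ (suc a) n = trans (⊛-identityˡ (onePS ^ₚ a) n) (onePS-^ a n)

  zeroPS : PS
  zeroPS _ = 0ℚ

  ⊛-zero : ∀ F → (F ⊛ zeroPS) ≗ₚ zeroPS
  ⊛-zero F n = trans (sumUpTo-cong n (λ i _ → *-zeroʳ (F i))) (sumUpTo-0 n)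

  ΣP : ℕ → (ℕ → PS) → PS
  ΣP N G j = sumUpTo N (λ s → G s j)

  ⊛-ΣP : ∀ N F G → (F ⊛ ΣP N G) ≗ₚ ΣP N (λ s → F ⊛ G s)
  ⊛-ΣP zero F G n = refl
  ⊛-ΣP (suc N) F G n = trans (⊛-distribˡ (ΣP N G) (G (suc N)) F n) (cong (_+ (F ⊛ G (suc N)) n) (⊛-ΣP N F G n))

  ΣP-cong : ∀ N {G G' : ℕ → PS} → (∀ s → s ℕ.≤ N → G s ≗ₚ G' s) → ΣP N G ≗ₚ ΣP N G'
  ΣP-cong N e j = sumUpTo-cong N (λ s s≤N → e s s≤N j)

  P I : PS
  P = onePlusT
  I = invOnePlusT

  P⊛I : (P ⊛ I) ≗ₚ onePS
  P⊛I zero = refl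
  P⊛I (suc zero) = refl
  P⊛I (suc (suc m)) = begin
    sumUpTo (suc (suc m)) (λ i → P i * I (suc (suc m) ∸ i)) ≡⟨ sumUpTo-shift (suc m) (λ i → P i * I (suc (suc m) ∸ i)) ⟩
    P 0 * I (suc (suc m)) + sumUpTo (suc m) (λ i → P (suc i) * I (suc m ∸ i))
       ≡⟨ cong (P 0 * I (suc (suc m)) +_) (sumUpTo-shift m (λ i → P (suc i) * I (suc m ∸ i))) ⟩
    P 0 * I (suc (suc m)) + (P 1 * I (suc m) + sumUpTo m (λ i → 0ℚ * I (m ∸ i)))
       ≡⟨ cong₂ (λ x y → x + (y + sumUpTo m (λ i → 0ℚ * I (m ∸ i)))) (*-identityˡ (I (suc (suc m)))) (*-identityˡ (I (suc m))) ⟩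
    sgn (suc (suc m)) + (sgn (suc m) + sumUpTo m (λ i → 0ℚ * I (m ∸ i)))
       ≡⟨ cong (λ x → sgn (suc (suc m)) + (sgn (suc m) + x)) (trans (sumUpTo-cong m (λ i _ → *-zeroˡ (I (m ∸ i)))) (sumUpTo-0 m)) ⟩
    (- (- sgn m)) + ((- sgn m) + 0ℚ) ≡⟨ cong (λ x → (- (- sgn m)) + x) (+-identityʳ (- sgn m)) ⟩
    (- (- sgn m)) + (- sgn m) ≡⟨ +-inverseˡ (- sgn m) ⟩
    0ℚ ∎

  P^⊛I^ : ∀ a → ((P ^ₚ a) ⊛ (I ^ₚ a)) ≗ₚ onePS
  P^⊛I^ a n = trans (sym (⊛-^ₚ P I a n)) (trans (^ₚ-cong a P⊛I n) (onePS-^ a n))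

module NatToRational where

  open import Data.Nat as ℕ using (suc)
  open import Data.Integer as ℤ using () renaming (+_ to ⁺_)
  import Data.Integer.Properties as ℤP
  open import Data.Rational using (_+_; _*_; _/_; 1ℚ)
  open import Data.Rational.Properties using (toℚᵘ-injective; toℚᵘ-fromℚᵘ; toℚᵘ-homo-+; toℚᵘ-homo-*)
  import Data.Rational.Unnormalised as U
  import Data.Rational.Unnormalised.Properties as UP
  open import Relation.Binary.PropositionalEquality

  private
    m/1 : ℕ → U.ℚᵘ
    m/1 m = U.mkℚᵘ (⁺ m) 0

  ℕtoℚ-+ : ∀ a b → ℕtoℚ (a ℕ.+ b) ≡ ℕtoℚ a + ℕtoℚ b
  ℕtoℚ-+ a b = toℚᵘ-injective (UP.≃-trans (toℚᵘ-fromℚᵘ (m/1 (a ℕ.+ b)))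
     (UP.≃-trans (UP.≃-sym (UP.≃-trans (UP.+-cong (toℚᵘ-fromℚᵘ (m/1 a)) (toℚᵘ-fromℚᵘ (m/1 b))) (U.*≡* eq)))
        (UP.≃-sym (toℚᵘ-homo-+ (ℕtoℚ a) (ℕtoℚ b)))))
    where eq : ((⁺ a) ℤ.* (⁺ 1) ℤ.+ (⁺ b) ℤ.* (⁺ 1)) ℤ.* (⁺ 1) ≡ (⁺ (a ℕ.+ b)) ℤ.* (⁺ 1)
          eq = trans (ℤP.*-identityʳ _) (trans (cong₂ ℤ._+_ (ℤP.*-identityʳ (⁺ a)) (ℤP.*-identityʳ (⁺ b))) (trans (sym (ℤP.pos-+ a b)) (sym (ℤP.*-identityʳ _))))

  ℕtoℚ-* : ∀ a b → ℕtoℚ (a ℕ.* b) ≡ ℕtoℚ a * ℕtoℚ b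
  ℕtoℚ-* a b = toℚᵘ-injective (UP.≃-trans (toℚᵘ-fromℚᵘ (m/1 (a ℕ.* b)))
     (UP.≃-trans (UP.≃-sym (UP.≃-trans (UP.*-cong (toℚᵘ-fromℚᵘ (m/1 a)) (toℚᵘ-fromℚᵘ (m/1 b))) (U.*≡* eq)))
        (UP.≃-sym (toℚᵘ-homo-* (ℕtoℚ a) (ℕtoℚ b)))))
    where eq : ((⁺ a) ℤ.* (⁺ b)) ℤ.* (⁺ 1) ≡ (⁺ (a ℕ.* b)) ℤ.* (⁺ 1)
          eq = cong (ℤ._* (⁺ 1)) (sym (ℤP.pos-* a b))

  1/d*d≡1 : ∀ d .{{_ : ℕ.NonZero d}} → ((⁺ 1) / d) * ℕtoℚ d ≡ 1ℚ
  1/d*d≡1 (suc d) = toℚᵘ-injective (UP.≃-trans (toℚᵘ-homo-* ((⁺ 1) / suc d) (ℕtoℚ (suc d)))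
    (UP.≃-trans (UP.*-cong (toℚᵘ-fromℚᵘ (U.mkℚᵘ (⁺ 1) d)) (toℚᵘ-fromℚᵘ (m/1 (suc d)))) (UP.*-inverseˡ (m/1 (suc d)))))

module Binomials where

  open import Data.Nat using (zero; suc; _+_; _*_; _∸_; _!; NonZero; _/_)
  import Data.Nat.Properties as ℕP
  open import Data.Nat.Combinatorics using (_C_; nCk+nC[k+1]≡[n+1]C[k+1]; nC1≡n; nCk≡n!/k![n-k]!; k![n∸k]!∣n!)
  open import Data.Nat.DivMod using (m*[n/m]≡n)
  open import Data.Nat.Solver using (module +-*-Solver)
  open +-*-Solver
  open import Relation.Binary.PropositionalEquality
  open ≡-Reasoning

  C2-suc : ∀ n → suc n C 2 ≡ n C 2 + n
  C2-suc n = trans (sym (nCk+nC[k+1]≡[n+1]C[k+1] n 1)) (trans (cong (_+ n C 2) (nC1≡n n)) (ℕP.+-comm n (n C 2)))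

  C2-split : ∀ s m → (s + m) C 2 ≡ s C 2 + (m C 2 + s * m)
  C2-split zero m = sym (ℕP.+-identityʳ (m C 2))
  C2-split (suc s) m = begin
    suc (s + m) C 2 ≡⟨ C2-suc (s + m) ⟩
    (s + m) C 2 + (s + m) ≡⟨ cong (_+ (s + m)) (C2-split s m) ⟩
    s C 2 + (m C 2 + s * m) + (s + m) ≡⟨ rearrange (s C 2) (m C 2) s m ⟩
    (s C 2 + s) + (m C 2 + (m + s * m)) ≡⟨ cong (_+ (m C 2 + (m + s * m))) (sym (C2-suc s)) ⟩
    suc s C 2 + (m C 2 + suc s * m) ∎
    where
    rearrange : ∀ a c s m → a + (c + s * m) + (s + m) ≡ (a + s) + (c + (m + s * m))
    rearrange = solve 4 (λ a c s m → a :+ (c :+ s :* m) :+ (s :+ m) := (a :+ s) :+ (c :+ (m :+ s :* m))) refl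

  binomial-factorials : ∀ s m → (((s + m) C s) * m !) * s ! ≡ (s + m) !
  binomial-factorials s m = begin
    ((N C s) * m !) * s ! ≡⟨ cong (λ x → ((N C s) * x !) * s !) (sym N∸s≡m) ⟩
    ((N C s) * (N ∸ s) !) * s ! ≡⟨ rearrange (N C s) ((N ∸ s) !) (s !) ⟩
    (s ! * (N ∸ s) !) * (N C s) ≡⟨ cong ((s ! * (N ∸ s) !) *_) (nCk≡n!/k![n-k]! s≤N) ⟩
    (s ! * (N ∸ s) !) * (N ! / (s ! * (N ∸ s) !)) ≡⟨ m*[n/m]≡n (k![n∸k]!∣n! s≤N) ⟩
    N ! ∎
    where
    N : ℕ
    N = s + m
    instance
      _ : NonZero (s ! * (N ∸ s) !)
      _ = ℕP._!*_!≢0 s (N ∸ s)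
    s≤N : s ≤ N
    s≤N = ℕP.m≤m+n s m
    N∸s≡m : N ∸ s ≡ m
    N∸s≡m = ℕP.m+n∸m≡n s m
    rearrange : ∀ a b c → (a * b) * c ≡ (c * b) * a
    rearrange = solve 3 (λ a b c → (a :* b) :* c := (c :* b) :* a) refl

module Recurrence where

  open import Data.Nat as ℕ using (zero; suc; _∸_; s≤s)
  import Data.Nat.Properties as ℕP
  open import Data.Nat.Combinatorics using (_C_)
  open import Data.Rational using (ℚ; 0ℚ; _+_; _*_; -_)
  open import Data.Rational.Properties using (*-identityˡ; +-0-group)
  open import Algebra.Properties.Group +-0-group using (inverseˡ-unique)
  open import Relation.Nullary using (yes; no)
  open import Relation.Binary.PropositionalEquality
  open ≡-Reasoning
  open PowerSeries

  RecTerm : (ℕ → PS) → ℕ → ℕ → PS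
  RecTerm X N s = scalePS (sgn s * ℕtoℚ (N C s)) ((P ^ₚ (s ℕ.* (N ∸ s))) ⊛ X (N ∸ s))

  Rec : (ℕ → PS) → ℕ → Set
  Rec X N = ΣP N (RecTerm X N) ≗ₚ zeroPS

  RecTerm-cong : ∀ {X X'} N s → X (N ∸ s) ≗ₚ X' (N ∸ s) → RecTerm X N s ≗ₚ RecTerm X' N s
  RecTerm-cong N s e j = cong ((sgn s * ℕtoℚ (N C s)) *_) (⊛-congʳ (P ^ₚ (s ℕ.* (N ∸ s))) e j)

  Rec-leading : ∀ X N j → Rec X (suc N) → X (suc N) j ≡ - sumUpTo N (λ s → RecTerm X (suc N) (suc s) j)
  Rec-leading X N j r = inverseˡ-unique (X (suc N) j) rest (begin
    X (suc N) j + rest ≡⟨ cong (_+ rest) (sym (trans (*-identityˡ ((onePS ⊛ X (suc N)) j)) (⊛-identityˡ (X (suc N)) j))) ⟩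
    RecTerm X (suc N) 0 j + rest ≡⟨ sym (sumUpTo-shift N (λ s → RecTerm X (suc N) s j)) ⟩
    ΣP (suc N) (RecTerm X (suc N)) j ≡⟨ r j ⟩
    0ℚ ∎)
    where
    rest : ℚ
    rest = sumUpTo N (λ s → RecTerm X (suc N) (suc s) j)

  Rec-unique : ∀ X X' → X 0 ≗ₚ X' 0 → (∀ n → Rec X (suc n)) → (∀ n → Rec X' (suc n)) → ∀ N → X N ≗ₚ X' N
  Rec-unique X X' e0 r r' N = below N N ℕP.≤-refl
    where
    below : ∀ K m → m ℕ.≤ K → X m ≗ₚ X' m
    below K zero _ = e0
    below (suc K) (suc m) (s≤s m≤K) j with m ℕ.≟ K
    ... | no m≢K = below K (suc m) (ℕP.≤∧≢⇒< m≤K m≢K) j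
    ... | yes refl = begin
      X (suc m) j ≡⟨ Rec-leading X m j (r m) ⟩
      - sumUpTo m (λ s → RecTerm X (suc m) (suc s) j)
        ≡⟨ cong -_ (sumUpTo-cong m (λ s s≤m → RecTerm-cong {X} {X'} (suc m) (suc s) (below m (m ∸ s) (ℕP.m∸n≤m m s)) j)) ⟩
      - sumUpTo m (λ s → RecTerm X' (suc m) (suc s) j) ≡⟨ sym (Rec-leading X' m j (r' m)) ⟩
      X' (suc m) j ∎

-- The analytic side: Y satisfies the recurrence, with Y 0 = 1.
-- With bₙ = [zⁿ] 1/Z(-z,t) and Zneg k = [zᵏ] Z(-z,t), the defining relation of the
-- reciprocal is Σ_{k≤N} Zneg k · b(N-k) = 0 for N ≥ 1; each term of the recurrence for Y
-- is N!(1+t)^{C(N,2)} times the corresponding term of this relation.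
module AnalyticSide where

  open import Data.Nat as ℕ using (zero; suc; _∸_; _!)
  import Data.Nat.Properties as ℕP
  open import Data.Nat.Combinatorics using (_C_)
  open import Data.Integer using () renaming (+_ to ⁺_)
  open import Data.Rational using (ℚ; 0ℚ; 1ℚ; _+_; _*_; -_; _/_)
  open import Data.Rational.Properties using (+-identityʳ; +-inverseˡ; *-identityˡ; *-identityʳ; *-zeroʳ; *-assoc; *-comm)
  open import Data.Rational.Solver using (module +-*-Solver)
  open import Data.Fin as F using (Fin; toℕ)
  open import Data.Vec using (lookup; head)
  open import Relation.Binary.PropositionalEquality
  open ≡-Reasoning
  open PowerSeries
  open NatToRational
  open Binomials
  open Recurrence

  b : ℕ → PS
  b = invZnegCoeff

  lookup-invVec : ∀ f n (i : Fin (suc n)) → lookup (invVec f n) i ≡ head (invVec f (n ∸ toℕ i))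
  lookup-invVec f zero F.zero = refl
  lookup-invVec f (suc n) F.zero = refl
  lookup-invVec f (suc n) (F.suc i) = lookup-invVec f n i

  sumFin-cong : ∀ m {f g : Fin m → ℚ} → (∀ i → f i ≡ g i) → sumFin m f ≡ sumFin m g
  sumFin-cong zero e = refl
  sumFin-cong (suc m) e = cong₂ _+_ (e F.zero) (sumFin-cong m (λ i → e (F.suc i)))

  sumFin-toℕ : ∀ n (h : ℕ → ℚ) → sumFin (suc n) (λ i → h (toℕ i)) ≡ sumUpTo n h
  sumFin-toℕ zero h = +-identityʳ (h 0)
  sumFin-toℕ (suc n) h = trans (cong (h 0 +_) (sumFin-toℕ n (λ k → h (suc k)))) (sym (sumUpTo-shift n h))

  b-suc : ∀ n j → b (suc n) j ≡ - sumUpTo n (λ k → (Zneg (suc k) ⊛ b (n ∸ k)) j)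
  b-suc n j = cong -_ (trans (sumFin-cong (suc n) (λ i → cong (λ v → (Zneg (suc (toℕ i)) ⊛ v) j) (lookup-invVec Zneg n i)))
                              (sumFin-toℕ n (λ k → (Zneg (suc k) ⊛ b (n ∸ k)) j)))

  Zneg0 : Zneg 0 ≗ₚ onePS
  Zneg0 zero = refl
  Zneg0 (suc j) = refl

  reciprocal-relation : ∀ n j → sumUpTo (suc n) (λ k → (Zneg k ⊛ b (suc n ∸ k)) j) ≡ 0ℚ
  reciprocal-relation n j = begin
    sumUpTo (suc n) (λ k → (Zneg k ⊛ b (suc n ∸ k)) j) ≡⟨ sumUpTo-shift n (λ k → (Zneg k ⊛ b (suc n ∸ k)) j) ⟩
    (Zneg 0 ⊛ b (suc n)) j + S ≡⟨ cong (_+ S) (trans (⊛-congˡ (b (suc n)) Zneg0 j) (⊛-identityˡ (b (suc n)) j)) ⟩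
    b (suc n) j + S ≡⟨ cong (_+ S) (b-suc n j) ⟩
    - S + S ≡⟨ +-inverseˡ S ⟩
    0ℚ ∎
    where
    S : ℚ
    S = sumUpTo n (λ k → (Zneg (suc k) ⊛ b (n ∸ k)) j)

  1/_! : ℕ → ℚ
  1/ s ! = ((⁺ 1) / (s !)) {{ℕP._!≢0 s}}

  binomial-ratio : ∀ s m → ℕtoℚ ((s ℕ.+ m) C s) * ℕtoℚ (m !) ≡ ℕtoℚ ((s ℕ.+ m) !) * 1/ s !
  binomial-ratio s m = begin
    c * f ≡⟨ sym (ℕtoℚ-* ((s ℕ.+ m) C s) (m !)) ⟩
    ℕtoℚ cf ≡⟨ sym (*-identityʳ _) ⟩
    ℕtoℚ cf * 1ℚ ≡⟨ cong (ℕtoℚ cf *_) (sym (trans (*-comm (ℕtoℚ (s !)) (1/ s !)) (1/d*d≡1 (s !) {{ℕP._!≢0 s}}))) ⟩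
    ℕtoℚ cf * (ℕtoℚ (s !) * 1/ s !) ≡⟨ sym (*-assoc (ℕtoℚ cf) (ℕtoℚ (s !)) (1/ s !)) ⟩
    (ℕtoℚ cf * ℕtoℚ (s !)) * 1/ s ! ≡⟨ cong (_* 1/ s !) (sym (ℕtoℚ-* cf (s !))) ⟩
    ℕtoℚ (cf ℕ.* s !) * 1/ s ! ≡⟨ cong (λ x → ℕtoℚ x * 1/ s !) (binomial-factorials s m) ⟩
    ℕtoℚ ((s ℕ.+ m) !) * 1/ s ! ∎
    where
    c f : ℚ
    c = ℕtoℚ ((s ℕ.+ m) C s)
    f = ℕtoℚ (m !)
    cf : ℕ
    cf = ((s ℕ.+ m) C s) ℕ.* m !

  power-bookkeeping : ∀ s m X →
    ((P ^ₚ ((s ℕ.+ m) C 2)) ⊛ ((I ^ₚ (s C 2)) ⊛ X)) ≗ₚ (((P ^ₚ (s ℕ.* m)) ⊛ (P ^ₚ (m C 2))) ⊛ X)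
  power-bookkeeping s m X j = begin
    (PN ⊛ (D ⊛ X)) j ≡⟨ ⊛-congˡ (D ⊛ X) split j ⟩
    ((Cs ⊛ E) ⊛ (D ⊛ X)) j ≡⟨ ⊛-congˡ (D ⊛ X) (⊛-comm Cs E) j ⟩
    ((E ⊛ Cs) ⊛ (D ⊛ X)) j ≡⟨ ⊛-assoc E Cs (D ⊛ X) j ⟩
    (E ⊛ (Cs ⊛ (D ⊛ X))) j ≡⟨ ⊛-congʳ E cancel j ⟩
    (E ⊛ X) j ≡⟨ ⊛-congˡ X (⊛-comm B A) j ⟩
    ((A ⊛ B) ⊛ X) j ∎
    where
    A B Cs D PN E : PS
    A = P ^ₚ (s ℕ.* m)
    B = P ^ₚ (m C 2)
    Cs = P ^ₚ (s C 2)
    D = I ^ₚ (s C 2)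
    PN = P ^ₚ ((s ℕ.+ m) C 2)
    E = B ⊛ A
    split : PN ≗ₚ (Cs ⊛ E)
    split k = trans (cong (λ x → (P ^ₚ x) k) (C2-split s m))
                    (trans (^ₚ-+ P (s C 2) (m C 2 ℕ.+ s ℕ.* m) k) (⊛-congʳ Cs (^ₚ-+ P (m C 2) (s ℕ.* m)) k))
    cancel : (Cs ⊛ (D ⊛ X)) ≗ₚ X
    cancel k = trans (sym (⊛-assoc Cs D X k)) (trans (⊛-congˡ X (P^⊛I^ (s C 2)) k) (⊛-identityˡ X k))

  Y-term : ∀ s m → scalePS (sgn s * ℕtoℚ ((s ℕ.+ m) C s)) ((P ^ₚ (s ℕ.* m)) ⊛ Y m)
                 ≗ₚ scalePS (ℕtoℚ ((s ℕ.+ m) !)) ((P ^ₚ ((s ℕ.+ m) C 2)) ⊛ (Zneg s ⊛ b m))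
  Y-term s m j = begin
    (σ * c) * (A ⊛ (B ⊛ scalePS f (b m))) j
      ≡⟨ cong ((σ * c) *_) (trans (⊛-congʳ A (scale-⊛ʳ f B (b m)) j) (scale-⊛ʳ f A (B ⊛ b m) j)) ⟩
    (σ * c) * (f * (A ⊛ (B ⊛ b m)) j) ≡⟨ move-scalars σ c f n (1/ s !) _ (binomial-ratio s m) ⟩
    n * ((σ * 1/ s !) * (A ⊛ (B ⊛ b m)) j)
      ≡⟨ cong (λ x → n * ((σ * 1/ s !) * x)) (trans (sym (⊛-assoc A B (b m) j)) (sym (power-bookkeeping s m (b m) j))) ⟩
    n * ((σ * 1/ s !) * (PN ⊛ (D ⊛ b m)) j)
      ≡⟨ cong (n *_) (sym (trans (⊛-congʳ PN (scale-⊛ˡ (σ * 1/ s !) D (b m)) j) (scale-⊛ʳ (σ * 1/ s !) PN (D ⊛ b m) j))) ⟩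
    n * (PN ⊛ (Zneg s ⊛ b m)) j ∎
    where
    σ c f n : ℚ
    σ = sgn s
    c = ℕtoℚ ((s ℕ.+ m) C s)
    f = ℕtoℚ (m !)
    n = ℕtoℚ ((s ℕ.+ m) !)
    A B D PN : PS
    A = P ^ₚ (s ℕ.* m)
    B = P ^ₚ (m C 2)
    D = I ^ₚ (s C 2)
    PN = P ^ₚ ((s ℕ.+ m) C 2)
    move-scalars : ∀ σ c f n v w → c * f ≡ n * v → (σ * c) * (f * w) ≡ n * ((σ * v) * w)
    move-scalars σ c f n v w cf≡nv = begin
      (σ * c) * (f * w) ≡⟨ solve 4 (λ σ c f w → (σ :* c) :* (f :* w) := σ :* (c :* f) :* w) refl σ c f w ⟩
      σ * (c * f) * w ≡⟨ cong (λ x → σ * x * w) cf≡nv ⟩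
      σ * (n * v) * w ≡⟨ solve 4 (λ σ n v w → σ :* (n :* v) :* w := n :* ((σ :* v) :* w)) refl σ n v w ⟩
      n * ((σ * v) * w) ∎
      where open +-*-Solver

  Y-term′ : ∀ N s → s ℕ.≤ N → RecTerm Y N s ≗ₚ scalePS (ℕtoℚ (N !)) ((P ^ₚ (N C 2)) ⊛ (Zneg s ⊛ b (N ∸ s)))
  Y-term′ N s s≤N j = subst (λ K → scalePS (sgn s * ℕtoℚ (K C s)) ((P ^ₚ (s ℕ.* (N ∸ s))) ⊛ Y (N ∸ s)) j
                                    ≡ scalePS (ℕtoℚ (K !)) ((P ^ₚ (K C 2)) ⊛ (Zneg s ⊛ b (N ∸ s))) j)
                            (ℕP.m+[n∸m]≡n s≤N) (Y-term s (N ∸ s) j)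

  Y-rec : ∀ n → Rec Y (suc n)
  Y-rec n j = begin
    ΣP N (RecTerm Y N) j ≡⟨ ΣP-cong N (λ s s≤N → Y-term′ N s s≤N) j ⟩
    sumUpTo N (λ s → c * (PN ⊛ G s) j) ≡⟨ sym (sumUpTo-*ˡ N c (λ s → (PN ⊛ G s) j)) ⟩
    c * ΣP N (λ s → PN ⊛ G s) j ≡⟨ cong (c *_) (sym (⊛-ΣP N PN G j)) ⟩
    c * (PN ⊛ ΣP N G) j ≡⟨ cong (c *_) (⊛-congʳ PN (reciprocal-relation n) j) ⟩
    c * (PN ⊛ zeroPS) j ≡⟨ cong (c *_) (⊛-zero PN j) ⟩
    c * 0ℚ ≡⟨ *-zeroʳ c ⟩
    0ℚ ∎
    where
    N : ℕ
    N = suc n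
    c : ℚ
    c = ℕtoℚ (N !)
    PN : PS
    PN = P ^ₚ (N C 2)
    G : ℕ → PS
    G s = Zneg s ⊛ b (N ∸ s)

  Y0 : Y 0 ≗ₚ onePS
  Y0 j = trans (⊛-identityˡ (scalePS 1ℚ onePS) j) (*-identityˡ (onePS j))

module MatrixStatistics where

  open import Data.Bool using (Bool; true; if_then_else_; _∧_; not)
  import Data.Bool.Properties as BP
  open import Data.Nat using (zero; suc; _+_)
  import Data.Nat.Properties as ℕP
  open import Data.Fin as F using (Fin; punchIn; _≟_)
  import Data.Fin.Properties as FP
  open import Data.List using (map; foldr; allFin; tabulate)
  import Data.List.Properties as LP
  open import Data.Nat.ListAction using (sum)
  open import Function using (_∘_; id)
  open import Relation.Nullary using (yes; no; does)
  open import Relation.Nullary.Decidable using (dec-true; dec-false)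
  open import Relation.Binary.PropositionalEquality
  open ≡-Reasoning

  Mat : ℕ → Set
  Mat n = Fin n → Fin n → Bool

  module Fold {A : Set} (_∙_ : A → A → A) (ε : A)
              (assoc : ∀ x y z → (x ∙ y) ∙ z ≡ x ∙ (y ∙ z)) (comm : ∀ x y → x ∙ y ≡ y ∙ x)
              (identityˡ : ∀ x → ε ∙ x ≡ x) where

    FT : ∀ n → (Fin n → A) → A
    FT n f = foldr _∙_ ε (tabulate f)

    FT-cong : ∀ n {f g : Fin n → A} → (∀ i → f i ≡ g i) → FT n f ≡ FT n g
    FT-cong n e = cong (foldr _∙_ ε) (LP.tabulate-cong e)

    swap : ∀ x y z → x ∙ (y ∙ z) ≡ y ∙ (x ∙ z)
    swap x y z = trans (sym (assoc x y z)) (trans (cong (_∙ z) (comm x y)) (assoc y x z))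

    FT-punch : ∀ n (v : Fin (suc n)) (f : Fin (suc n) → A) → FT (suc n) f ≡ f v ∙ FT n (f ∘ punchIn v)
    FT-punch n F.zero f = refl
    FT-punch (suc n) (F.suc v) f = trans (cong (f F.zero ∙_) (FT-punch n v (f ∘ F.suc))) (swap (f F.zero) (f (F.suc v)) _)

    FT-∙ : ∀ n (f g : Fin n → A) → FT n (λ i → f i ∙ g i) ≡ FT n f ∙ FT n g
    FT-∙ zero f g = sym (identityˡ ε)
    FT-∙ (suc n) f g = begin
      (f F.zero ∙ g F.zero) ∙ FT n (λ i → f (F.suc i) ∙ g (F.suc i))
        ≡⟨ cong ((f F.zero ∙ g F.zero) ∙_) (FT-∙ n (f ∘ F.suc) (g ∘ F.suc)) ⟩
      (f F.zero ∙ g F.zero) ∙ (Ff ∙ Fg) ≡⟨ assoc (f F.zero) (g F.zero) (Ff ∙ Fg) ⟩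
      f F.zero ∙ (g F.zero ∙ (Ff ∙ Fg)) ≡⟨ cong (f F.zero ∙_) (swap (g F.zero) Ff Fg) ⟩
      f F.zero ∙ (Ff ∙ (g F.zero ∙ Fg)) ≡⟨ sym (assoc (f F.zero) Ff (g F.zero ∙ Fg)) ⟩
      (f F.zero ∙ Ff) ∙ (g F.zero ∙ Fg) ∎
      where
      Ff Fg : A
      Ff = FT n (f ∘ F.suc)
      Fg = FT n (g ∘ F.suc)

    FT-ε : ∀ n → FT n (λ _ → ε) ≡ ε
    FT-ε zero = refl
    FT-ε (suc n) = trans (cong (ε ∙_) (FT-ε n)) (identityˡ ε)

    FT-map : ∀ n (f : Fin n → A) → foldr _∙_ ε (map f (allFin n)) ≡ FT n f
    FT-map n f = cong (foldr _∙_ ε) (LP.map-tabulate id f)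

  module ΣF = Fold _+_ 0 ℕP.+-assoc ℕP.+-comm ℕP.+-identityˡ
  module ∧F = Fold _∧_ true BP.∧-assoc BP.∧-comm BP.∧-identityˡ

  ΣT : ∀ n → (Fin n → ℕ) → ℕ
  ΣT = ΣF.FT

  ∧T : ∀ n → (Fin n → Bool) → Bool
  ∧T = ∧F.FT

  ∧T-true⇒ : ∀ n (f : Fin n → Bool) → ∧T n f ≡ true → ∀ i → f i ≡ true
  ∧T-true⇒ (suc n) f e F.zero = BP.∧-conicalˡ (f F.zero) _ e
  ∧T-true⇒ (suc n) f e (F.suc i) = ∧T-true⇒ n (f ∘ F.suc) (BP.∧-conicalʳ (f F.zero) _ e) i

  ∧T-true⇐ : ∀ n (f : Fin n → Bool) → (∀ i → f i ≡ true) → ∧T n f ≡ true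
  ∧T-true⇐ zero f e = refl
  ∧T-true⇐ (suc n) f e rewrite e F.zero = ∧T-true⇐ n (f ∘ F.suc) (e ∘ F.suc)

  punch-≟ : ∀ {n} (v : Fin (suc n)) (i k : Fin n) → does (punchIn v i ≟ punchIn v k) ≡ does (i ≟ k)
  punch-≟ v i k with i ≟ k
  ... | yes refl = dec-true (punchIn v i ≟ punchIn v i) refl
  ... | no ne = dec-false (punchIn v i ≟ punchIn v k) (ne ∘ FP.punchIn-injective v i k)

  offT : ∀ {n} → Mat n → ℕ
  offT {n} a = ΣT n (λ k → ΣT n (λ l → if does (k ≟ l) then 0 else b2n (a k l)))

  diagT : ∀ {n} → Mat n → Bool
  diagT {n} a = ∧T n (λ k → a k k)

  sinkᵇ : ∀ {n} → Mat n → Fin n → Bool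
  sinkᵇ {n} a k = ∧T n (λ i → if does (i ≟ k) then true else not (a i k))

  minor : ∀ {n} → Fin (suc n) → Mat (suc n) → Mat n
  minor v a i k = a (punchIn v i) (punchIn v k)

  offDiag≡ : ∀ {n} (M : Matrix n) → offDiagOnes M ≡ offT (entry M)
  offDiag≡ {n} M = trans (cong sum (LP.map-cong (λ k → ΣF.FT-map n _) (allFin n))) (ΣF.FT-map n _)

  diag≡ : ∀ {n} (M : Matrix n) → diagonalAllOne M ≡ diagT (entry M)
  diag≡ {n} M = ∧F.FT-map n _

  offT-cong : ∀ {n} {a b : Mat n} → (∀ i k → a i k ≡ b i k) → offT a ≡ offT b
  offT-cong {n} e = ΣF.FT-cong n (λ k → ΣF.FT-cong n (λ l → cong (if does (k ≟ l) then 0 else_) (cong b2n (e k l))))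

  diagT-cong : ∀ {n} {a b : Mat n} → (∀ i k → a i k ≡ b i k) → diagT a ≡ diagT b
  diagT-cong {n} e = ∧F.FT-cong n (λ k → e k k)

  sinkᵇ-cong : ∀ {n} {a b : Mat n} → (∀ i k → a i k ≡ b i k) → ∀ k → sinkᵇ a k ≡ sinkᵇ b k
  sinkᵇ-cong {n} e k = ∧F.FT-cong n (λ i → cong (if does (i ≟ k) then true else_) (cong not (e i k)))

  offT-punch : ∀ {n} (v : Fin (suc n)) (a : Mat (suc n)) →
    offT a ≡ offT (minor v a) + (ΣT n (λ k → b2n (a v (punchIn v k))) + ΣT n (λ i → b2n (a (punchIn v i) v)))
  offT-punch {n} v a = begin
    offT a ≡⟨ ΣF.FT-punch n v row ⟩
    row v + ΣT n (λ i → row (punchIn v i)) ≡⟨ cong₂ _+_ row-v (ΣF.FT-cong n row-other) ⟩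
    rowOut + ΣT n (λ i → b2n (a (punchIn v i) v) + minorRow i) ≡⟨ cong (rowOut +_) (ΣF.FT-∙ n (λ i → b2n (a (punchIn v i) v)) minorRow) ⟩
    rowOut + (colOut + offT (minor v a)) ≡⟨ cong (rowOut +_) (ℕP.+-comm colOut _) ⟩
    rowOut + (offT (minor v a) + colOut) ≡⟨ ΣF.swap rowOut (offT (minor v a)) colOut ⟩
    offT (minor v a) + (rowOut + colOut) ∎
    where
    row : Fin (suc n) → ℕ
    row k = ΣT (suc n) (λ l → if does (k ≟ l) then 0 else b2n (a k l))
    minorRow : Fin n → ℕ
    minorRow i = ΣT n (λ l → if does (i ≟ l) then 0 else b2n (minor v a i l))
    rowOut colOut : ℕ
    rowOut = ΣT n (λ k → b2n (a v (punchIn v k)))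
    colOut = ΣT n (λ i → b2n (a (punchIn v i) v))
    row-v : row v ≡ rowOut
    row-v = begin
      row v ≡⟨ ΣF.FT-punch n v (λ l → if does (v ≟ l) then 0 else b2n (a v l)) ⟩
      (if does (v ≟ v) then 0 else b2n (a v v)) + ΣT n (λ k → if does (v ≟ punchIn v k) then 0 else b2n (a v (punchIn v k)))
        ≡⟨ cong₂ _+_ (cong (λ x → if x then 0 else b2n (a v v)) (dec-true (v ≟ v) refl))
                      (ΣF.FT-cong n (λ k → cong (λ x → if x then 0 else b2n (a v (punchIn v k))) (dec-false (v ≟ punchIn v k) (FP.punchInᵢ≢i v k ∘ sym)))) ⟩
      rowOut ∎
    row-other : ∀ i → row (punchIn v i) ≡ b2n (a (punchIn v i) v) + minorRow i
    row-other i = begin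
      row (punchIn v i) ≡⟨ ΣF.FT-punch n v (λ l → if does (punchIn v i ≟ l) then 0 else b2n (a (punchIn v i) l)) ⟩
      (if does (punchIn v i ≟ v) then 0 else b2n (a (punchIn v i) v)) + ΣT n (λ k → if does (punchIn v i ≟ punchIn v k) then 0 else b2n (a (punchIn v i) (punchIn v k)))
        ≡⟨ cong₂ _+_ (cong (λ x → if x then 0 else b2n (a (punchIn v i) v)) (dec-false (punchIn v i ≟ v) (FP.punchInᵢ≢i v i)))
                      (ΣF.FT-cong n (λ k → cong (λ x → if x then 0 else b2n (a (punchIn v i) (punchIn v k))) (punch-≟ v i k))) ⟩
      b2n (a (punchIn v i) v) + minorRow i ∎

  diagT-punch : ∀ {n} (v : Fin (suc n)) (a : Mat (suc n)) → diagT a ≡ a v v ∧ diagT (minor v a)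
  diagT-punch {n} v a = ∧F.FT-punch n v (λ k → a k k)

  sinkᵇ-v : ∀ {n} (v : Fin (suc n)) (a : Mat (suc n)) → sinkᵇ a v ≡ ∧T n (λ i → not (a (punchIn v i) v))
  sinkᵇ-v {n} v a = begin
    sinkᵇ a v ≡⟨ ∧F.FT-punch n v (λ i → if does (i ≟ v) then true else not (a i v)) ⟩
    (if does (v ≟ v) then true else not (a v v)) ∧ ∧T n (λ i → if does (punchIn v i ≟ v) then true else not (a (punchIn v i) v))
      ≡⟨ cong₂ _∧_ (cong (λ x → if x then true else not (a v v)) (dec-true (v ≟ v) refl))
                    (∧F.FT-cong n (λ i → cong (λ x → if x then true else not (a (punchIn v i) v)) (dec-false (punchIn v i ≟ v) (FP.punchInᵢ≢i v i)))) ⟩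
    ∧T n (λ i → not (a (punchIn v i) v)) ∎

  sinkᵇ-punch : ∀ {n} (v : Fin (suc n)) (a : Mat (suc n)) (k : Fin n) →
    sinkᵇ a (punchIn v k) ≡ not (a v (punchIn v k)) ∧ sinkᵇ (minor v a) k
  sinkᵇ-punch {n} v a k = begin
    sinkᵇ a (punchIn v k) ≡⟨ ∧F.FT-punch n v (λ i → if does (i ≟ punchIn v k) then true else not (a i (punchIn v k))) ⟩
    (if does (v ≟ punchIn v k) then true else not (a v (punchIn v k))) ∧ ∧T n (λ i → if does (punchIn v i ≟ punchIn v k) then true else not (a (punchIn v i) (punchIn v k)))
      ≡⟨ cong₂ _∧_ (cong (λ x → if x then true else not (a v (punchIn v k))) (dec-false (v ≟ punchIn v k) (FP.punchInᵢ≢i v k ∘ sym)))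
                    (∧F.FT-cong n (λ i → cong (λ x → if x then true else not (a (punchIn v i) (punchIn v k))) (punch-≟ v i k))) ⟩
    not (a v (punchIn v k)) ∧ sinkᵇ (minor v a) k ∎

module IdentityOnly where

  open import Data.Bool using (true; false)
  open import Data.Nat using (suc)
  open import Data.Fin using (Fin; punchIn; punchOut; _≟_)
  import Data.Fin.Properties as FP
  open import Function using (_∘_)
  open import Relation.Nullary using (yes; no)
  open import Relation.Nullary.Negation using (contradiction)
  open import Relation.Binary.PropositionalEquality
  open MatrixStatistics using (Mat; minor)

  Inj : ∀ {n} → (Fin n → Fin n) → Set
  Inj σ = ∀ i j → σ i ≡ σ j → i ≡ j

  Supp : ∀ {n} → Mat n → (Fin n → Fin n) → Set
  Supp a σ = ∀ k → a (σ k) k ≡ true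

  OnlyIdentity : ∀ {n} → Mat n → Set
  OnlyIdentity a = ∀ σ → Inj σ → Supp a σ → ∀ k → σ k ≡ k
  -- Deleting a vertex v with a v v = 1 preserves the property: a permutation of the
  -- minor extends by v ↦ v to a permutation supported by a.
  OnlyIdentity-minor : ∀ {n} (v : Fin (suc n)) (a : Mat (suc n)) → a v v ≡ true → OnlyIdentity a → OnlyIdentity (minor v a)
  OnlyIdentity-minor {n} v a avv only σ' inj' sp k' = FP.punchIn-injective v _ _ (trans (sym (σk k')) (only σ inj supp (punchIn v k')))
    where
    σ : Fin (suc n) → Fin (suc n)
    σ k with v ≟ k
    ... | yes _ = v
    ... | no v≢k = punchIn v (σ' (punchOut v≢k))
    σk : ∀ k' → σ (punchIn v k') ≡ punchIn v (σ' k')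
    σk k' with v ≟ punchIn v k'
    ... | yes e = contradiction (sym e) (FP.punchInᵢ≢i v k')
    ... | no v≢k = cong (punchIn v ∘ σ') (FP.punchOut-punchIn v)
    inj : Inj σ
    inj i j e with v ≟ i | v ≟ j
    ... | yes p | yes q = trans (sym p) q
    ... | yes p | no q = contradiction (sym e) (FP.punchInᵢ≢i v _)
    ... | no p | yes q = contradiction e (FP.punchInᵢ≢i v _)
    ... | no p | no q = FP.punchOut-injective p q (inj' _ _ (FP.punchIn-injective v _ _ e))
    supp : Supp a σ
    supp k with v ≟ k
    ... | yes refl = avv
    ... | no p = subst (λ x → a (punchIn v (σ' (punchOut p))) x ≡ true) (FP.punchIn-punchOut p) (sp (punchOut p))

  Sink : ∀ {n} → Mat n → Fin n → Set
  Sink a v = ∀ i → i ≢ v → a i v ≡ false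

  sink-fixed : ∀ {n} (a : Mat n) v σ → Sink a v → Supp a σ → σ v ≡ v
  sink-fixed a v σ sink sp with σ v ≟ v
  ... | yes e = e
  ... | no p = contradiction (trans (sym (sp v)) (sink (σ v) p)) λ ()

  -- Conversely, adding a sink v preserves it: a supported permutation must fix v
  -- (column v has its only one at (v,v)), so it restricts to the minor.
  OnlyIdentity-extend : ∀ {n} (v : Fin (suc n)) (a : Mat (suc n)) → Sink a v → OnlyIdentity (minor v a) → OnlyIdentity a
  OnlyIdentity-extend {n} v a sink only σ inj sp k with v ≟ k
  ... | yes refl = sink-fixed a v σ sink sp
  ... | no p = subst (λ x → σ x ≡ x) (FP.punchIn-punchOut p) (fixes (punchOut p))
    where
    ne : ∀ k' → v ≢ σ (punchIn v k')
    ne k' e = FP.punchInᵢ≢i v k' (inj _ _ (trans (sym e) (sym (sink-fixed a v σ sink sp))))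
    σ' : Fin n → Fin n
    σ' k' = punchOut (ne k')
    inj' : Inj σ'
    inj' i j e = FP.punchIn-injective v i j (inj _ _ (FP.punchOut-injective (ne i) (ne j) e))
    sp' : Supp (minor v a) σ'
    sp' k' = subst (λ x → a x (punchIn v k') ≡ true) (sym (FP.punchIn-punchOut (ne k'))) (sp (punchIn v k'))
    fixes : ∀ k' → σ (punchIn v k') ≡ punchIn v k'
    fixes k' = trans (sym (FP.punchIn-punchOut (ne k'))) (cong (punchIn v) (only σ' inj' sp' k'))

-- Otherwise every vertex v has a predecessor g v ≠ v with a (g v) v = 1;
-- iterating g from any vertex eventually repeats (pigeonhole), and on a shortest cycle
-- y, g y, …, g^(L-1) y the permutation "g on the cycle, identity elsewhere" is supported
-- by a and is not the identity.
module SinkExistence where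

  open import Data.Bool using (true; false)
  open import Data.Bool.Properties using () renaming (_≟_ to _≟B_)
  open import Data.Nat as ℕ using (zero; suc; _+_; _∸_; _<_; z≤n; s≤s)
  import Data.Nat.Properties as ℕP
  open import Data.Fin as F using (Fin; toℕ; fromℕ<)
  import Data.Fin.Properties as FP
  open import Data.Product using (Σ; _×_; _,_; proj₁; proj₂)
  open import Relation.Nullary using (yes; no; ¬_; Dec)
  open import Relation.Nullary.Decidable using (_×-dec_; _→-dec_; ¬?)
  open import Relation.Nullary.Negation using (contradiction)
  open import Relation.Binary.PropositionalEquality
  open import Relation.Binary.Definitions using (tri<; tri≈; tri>)
  open import Data.Empty using (⊥-elim; ⊥)
  open import Data.Sum using (inj₁; inj₂)
  open ≡-Reasoning
  open MatrixStatistics using (Mat)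
  open IdentityOnly

  least-witness : (Q : ℕ → Set) → (∀ n → Dec (Q n)) → ∀ L₀ → Q L₀ → Σ ℕ λ L → Q L × (∀ L' → L' < L → ¬ Q L')
  least-witness Q Q? L₀ qL₀ = search 0 L₀ refl (λ L' ())
    where
    search : ∀ k d → k + d ≡ L₀ → (∀ L' → L' < k → ¬ Q L') → Σ ℕ λ L → Q L × (∀ L' → L' < L → ¬ Q L')
    search k d e below with Q? k
    ... | yes qk = k , qk , below
    search k zero e below | no ¬qk = contradiction (subst Q (sym (trans (sym (ℕP.+-identityʳ k)) e)) qL₀) ¬qk
    search k (suc d) e below | no ¬qk = search (suc k) d (trans (sym (ℕP.+-suc k d)) e) below'
      where
      below' : ∀ L' → L' < suc k → ¬ Q L'
      below' L' (s≤s L'≤k) with ℕP.m≤n⇒m<n∨m≡n L'≤k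
      ... | inj₁ lt = below L' lt
      ... | inj₂ refl = ¬qk

  module Predecessors {N : ℕ} (a : Mat N) (diag : ∀ k → a k k ≡ true) (only : OnlyIdentity a)
                      (g : Fin N → Fin N) (g≢ : ∀ v → g v ≢ v) (g-one : ∀ v → a (g v) v ≡ true) where

    iter : ℕ → Fin N → Fin N
    iter zero x = x
    iter (suc t) x = g (iter t x)

    iter-+ : ∀ s t x → iter (s + t) x ≡ iter s (iter t x)
    iter-+ zero t x = refl
    iter-+ (suc s) t x = cong g (iter-+ s t x)

    module ShortestCycle (y : Fin N) (L : ℕ) (L≢0 : L ≢ 0) (period : iter L y ≡ y)
                         (minimal : ∀ L' → L' < L → ¬ (L' ≢ 0 × iter L' y ≡ y)) where

      distinct : ∀ t t' → t < t' → t' < L → iter t y ≢ iter t' y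
      distinct t t' t<t' t'<L e = minimal (L ∸ t' + t) shorter (nonzero , returns)
        where
        shorter : L ∸ t' + t < L
        shorter = ℕP.<-≤-trans (ℕP.+-monoʳ-< (L ∸ t') t<t') (ℕP.≤-reflexive (ℕP.m∸n+n≡m (ℕP.<⇒≤ t'<L)))
        nonzero : L ∸ t' + t ≢ 0
        nonzero z = ℕP.<⇒≢ (ℕP.<-≤-trans (ℕP.m<n⇒0<n∸m t'<L) (ℕP.≤-trans (ℕP.m≤m+n (L ∸ t') t) (ℕP.≤-reflexive z))) refl
        returns : iter (L ∸ t' + t) y ≡ y
        returns = begin
          iter (L ∸ t' + t) y ≡⟨ iter-+ (L ∸ t') t y ⟩
          iter (L ∸ t') (iter t y) ≡⟨ cong (iter (L ∸ t')) e ⟩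
          iter (L ∸ t') (iter t' y) ≡⟨ sym (iter-+ (L ∸ t') t' y) ⟩
          iter (L ∸ t' + t') y ≡⟨ cong (λ x → iter x y) (ℕP.m∸n+n≡m (ℕP.<⇒≤ t'<L)) ⟩
          iter L y ≡⟨ period ⟩
          y ∎

      distinct-positive : ∀ u u' → 0 < u → u < u' → u' ℕ.≤ L → iter u y ≢ iter u' y
      distinct-positive u u' 0<u u<u' u'≤L e with ℕP.m≤n⇒m<n∨m≡n u'≤L
      ... | inj₁ u'<L = distinct u u' u<u' u'<L e
      ... | inj₂ refl = distinct 0 u 0<u u<u' (sym (trans e period))

      iter-injective : ∀ u u' → 0 < u → u ℕ.≤ L → 0 < u' → u' ℕ.≤ L → iter u y ≡ iter u' y → u ≡ u'
      iter-injective u u' 0<u u≤L 0<u' u'≤L e with ℕP.<-cmp u u'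
      ... | tri≈ _ eq _ = eq
      ... | tri< u<u' _ _ = ⊥-elim (distinct-positive u u' 0<u u<u' u'≤L e)
      ... | tri> _ _ u'<u = ⊥-elim (distinct-positive u' u 0<u' u'<u u≤L (sym e))

      OnCycle : Fin N → Set
      OnCycle z = Σ (Fin L) λ t → iter (toℕ t) y ≡ z

      OnCycle? : ∀ z → Dec (OnCycle z)
      OnCycle? z = FP.any? (λ t → iter (toℕ t) y F.≟ z)

      y-OnCycle : OnCycle y
      y-OnCycle = fromℕ< (ℕP.n≢0⇒n>0 L≢0) , cong (λ x → iter x y) (FP.toℕ-fromℕ< (ℕP.n≢0⇒n>0 L≢0))

      g-OnCycle : ∀ {z} → OnCycle z → OnCycle (g z)
      g-OnCycle {z} (t , e) with ℕP.m≤n⇒m<n∨m≡n (FP.toℕ<n t)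
      ... | inj₁ st<L = fromℕ< st<L , trans (cong (λ x → iter x y) (FP.toℕ-fromℕ< st<L)) (cong g e)
      ... | inj₂ st≡L = proj₁ y-OnCycle , trans (proj₂ y-OnCycle)
                                             (trans (sym period) (trans (cong (λ x → iter x y) (sym st≡L)) (cong g e)))

      rotate : Fin N → Fin N
      rotate z with OnCycle? z
      ... | yes _ = g z
      ... | no _ = z

      rotate-injective : Inj rotate
      rotate-injective i j e with OnCycle? i | OnCycle? j
      ... | yes (t , ei) | yes (t' , ej) = trans (sym ei) (trans (cong (λ x → iter x y) t≡t') ej)
        where
        e' : iter (suc (toℕ t)) y ≡ iter (suc (toℕ t')) y
        e' = trans (cong g ei) (trans e (sym (cong g ej)))
        t≡t' : toℕ t ≡ toℕ t'
        t≡t' = ℕP.suc-injective (iter-injective _ _ (s≤s z≤n) (FP.toℕ<n t) (s≤s z≤n) (FP.toℕ<n t') e')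
      ... | yes ci | no nj = contradiction (subst OnCycle e (g-OnCycle ci)) nj
      ... | no ni | yes cj = contradiction (subst OnCycle (sym e) (g-OnCycle cj)) ni
      ... | no _ | no _ = e

      rotate-supported : Supp a rotate
      rotate-supported z with OnCycle? z
      ... | yes _ = g-one z
      ... | no _ = diag z

      absurd : ⊥
      absurd with only rotate rotate-injective rotate-supported y
      ... | e with OnCycle? y
      ... | yes _ = g≢ y e
      ... | no ny = ny y-OnCycle

  has-sink : ∀ {m} (a : Mat (suc m)) → (∀ k → a k k ≡ true) → OnlyIdentity a → Σ (Fin (suc m)) (Sink a)
  has-sink {m} a diag only with FP.any? sink?
    where
    sink? : ∀ v → Dec (Sink a v)
    sink? v = FP.all? (λ i → ¬? (i F.≟ v) →-dec (a i v ≟B false))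
  ... | yes s = s
  ... | no no-sink = ⊥-elim (ShortestCycle.absurd y (proj₁ least) (proj₁ (proj₁ (proj₂ least))) (proj₂ (proj₁ (proj₂ least))) (proj₂ (proj₂ least)))
    where
    predecessor : ∀ v → Σ (Fin (suc m)) λ i → i ≢ v × a i v ≡ true
    predecessor v with FP.any? (λ i → ¬? (i F.≟ v) ×-dec (a i v ≟B true))
    ... | yes r = proj₁ r , proj₂ r
    ... | no none = ⊥-elim (no-sink (v , sink))
      where
      sink : Sink a v
      sink i ne with a i v in eq
      ... | true = ⊥-elim (none (i , ne , eq))
      ... | false = refl
    open Predecessors a diag only (λ v → proj₁ (predecessor v)) (λ v → proj₁ (proj₂ (predecessor v))) (λ v → proj₂ (proj₂ (predecessor v)))
    -- Among the m+2 points iter t 0 (t ≤ m+1) two coincide: iter i 0 = iter j 0 with i < j.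
    f : Fin (suc (suc m)) → Fin (suc m)
    f t = iter (toℕ t) F.zero
    pigeon : Σ (Fin (suc (suc m))) λ i → Σ (Fin (suc (suc m))) λ j → toℕ i < toℕ j × f i ≡ f j
    pigeon = FP.pigeonhole (ℕP.n<1+n (suc m)) f
    i j : Fin (suc (suc m))
    i = proj₁ pigeon
    j = proj₁ (proj₂ pigeon)
    i<j : toℕ i < toℕ j
    i<j = proj₁ (proj₂ (proj₂ pigeon))
    y : Fin (suc m)
    y = f i
    Returns : ℕ → Set
    Returns L = L ≢ 0 × iter L y ≡ y
    returns : Returns (toℕ j ∸ toℕ i)
    returns = (λ z → ℕP.<⇒≢ (ℕP.<-≤-trans (ℕP.m<n⇒0<n∸m i<j) (ℕP.≤-reflexive z)) refl) ,
              trans (sym (iter-+ (toℕ j ∸ toℕ i) (toℕ i) F.zero))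
                    (trans (cong (λ x → iter x F.zero) (ℕP.m∸n+n≡m (ℕP.<⇒≤ i<j))) (sym (proj₂ (proj₂ (proj₂ pigeon)))))
    least : Σ ℕ λ L → Returns L × (∀ L' → L' < L → ¬ Returns L')
    least = least-witness Returns (λ L → ¬? (L ℕ.≟ 0) ×-dec (iter L y F.≟ y)) (toℕ j ∸ toℕ i) returns

-- The permanent of Defs is the number of words
-- σ ∈ (Fin n)ⁿ that are injective and supported by a; with unit diagonal the identity
-- word is always counted, so  per a ≡ 1  iff  OnlyIdentity a.
module PermanentOne where

  open import Data.Bool using (Bool; true; false; if_then_else_; _∧_)
  import Data.Bool.Properties as BP
  open import Data.Nat using (zero; suc; _+_; _*_; z≤n)
  import Data.Nat.Properties as ℕP
  open import Algebra.Properties.CommutativeSemigroup ℕP.+-commutativeSemigroup using (interchange)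
  open import Data.Fin as F using (Fin; punchIn; _≟_)
  import Data.Fin.Properties as FP
  open import Data.List as L using (List; []; _∷_; map; allFin; tabulate; concatMap; filterᵇ)
  import Data.List.Properties as LP
  open import Data.Nat.ListAction using (sum; product)
  open import Data.Vec as V using (Vec; lookup; toList)
  import Data.Vec.Properties as VP
  open import Data.List.Relation.Unary.All using (All; []; _∷_)
  open import Data.List.Relation.Unary.AllPairs using (AllPairs; []; _∷_)
  open import Data.List.Relation.Unary.Unique.DecPropositional using (unique?)
  open import Data.Product using (_×_; _,_; proj₁; proj₂)
  open import Function using (_∘_; id)
  open import Relation.Nullary using (yes; no; does; ¬_; Dec)
  open import Relation.Nullary.Decidable using (dec-true; dec-false)
  open import Relation.Binary.PropositionalEquality
  open import Data.Empty using (⊥-elim; ⊥)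
  open ≡-Reasoning
  open MatrixStatistics
  open IdentityOnly

  does-true : ∀ {A : Set} (d : Dec A) → does d ≡ true → A
  does-true (yes p) _ = p
  does-true (no _) ()

  LS : ∀ {A : Set} → List A → (A → ℕ) → ℕ
  LS xs f = sum (map f xs)

  LS-cong : ∀ {A : Set} (xs : List A) {f g : A → ℕ} → (∀ x → f x ≡ g x) → LS xs f ≡ LS xs g
  LS-cong [] e = refl
  LS-cong (x ∷ xs) e = cong₂ _+_ (e x) (LS-cong xs e)

  LS-++ : ∀ {A : Set} (xs ys : List A) f → LS (xs L.++ ys) f ≡ LS xs f + LS ys f
  LS-++ [] ys f = refl
  LS-++ (x ∷ xs) ys f = trans (cong (f x +_) (LS-++ xs ys f)) (sym (ℕP.+-assoc (f x) _ _))

  LS-map : ∀ {A B : Set} (xs : List A) (h : A → B) f → LS (map h xs) f ≡ LS xs (f ∘ h)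
  LS-map [] h f = refl
  LS-map (x ∷ xs) h f = cong (f (h x) +_) (LS-map xs h f)

  LS-concatMap : ∀ {A B : Set} (xs : List A) (g : A → List B) f → LS (concatMap g xs) f ≡ LS xs (λ x → LS (g x) f)
  LS-concatMap [] g f = refl
  LS-concatMap (x ∷ xs) g f = trans (LS-++ (g x) (concatMap g xs) f) (cong (LS (g x) f +_) (LS-concatMap xs g f))

  LS-+ : ∀ {A : Set} (xs : List A) f g → LS xs (λ x → f x + g x) ≡ LS xs f + LS xs g
  LS-+ [] f g = refl
  LS-+ (x ∷ xs) f g = trans (cong (f x + g x +_) (LS-+ xs f g)) (interchange (f x) (g x) _ _)

  LS-*ˡ : ∀ {A : Set} (xs : List A) c f → LS xs (λ x → c * f x) ≡ c * LS xs f
  LS-*ˡ [] c f = sym (ℕP.*-zeroʳ c)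
  LS-*ˡ (x ∷ xs) c f = trans (cong (c * f x +_) (LS-*ˡ xs c f)) (sym (ℕP.*-distribˡ-+ c (f x) _))

  LS-mono : ∀ {A : Set} (xs : List A) {f g : A → ℕ} → (∀ x → f x ≤ g x) → LS xs f ≤ LS xs g
  LS-mono [] e = z≤n
  LS-mono (x ∷ xs) e = ℕP.+-mono-≤ (e x) (LS-mono xs e)

  LS-filter : ∀ {A : Set} (p : A → Bool) (xs : List A) f → LS (filterᵇ p xs) f ≡ LS xs (λ x → if p x then f x else 0)
  LS-filter p [] f = refl
  LS-filter p (x ∷ xs) f with p x
  ... | true = cong (f x +_) (LS-filter p xs f)
  ... | false = LS-filter p xs f

  b2n-∧ : ∀ x y → b2n (x ∧ y) ≡ b2n x * b2n y
  b2n-∧ true y = sym (ℕP.+-identityʳ (b2n y))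
  b2n-∧ false y = refl

  product-b2n : ∀ {n} (h : Fin n → Bool) → product (map (b2n ∘ h) (allFin n)) ≡ b2n (∧T n h)
  product-b2n {n} h = trans (cong product (LP.map-tabulate id (b2n ∘ h))) (indicator-product n h)
    where
    indicator-product : ∀ n (h : Fin n → Bool) → product (tabulate (b2n ∘ h)) ≡ b2n (∧T n h)
    indicator-product zero h = refl
    indicator-product (suc n) h = trans (cong (b2n (h F.zero) *_) (indicator-product n (h ∘ F.suc))) (sym (b2n-∧ (h F.zero) _))

  count-allFin : ∀ {m} (c : Fin m) → LS (allFin m) (λ x → b2n (does (x ≟ c))) ≡ 1
  count-allFin {suc m} c = begin
    LS (allFin (suc m)) (λ x → b2n (does (x ≟ c))) ≡⟨ ΣF.FT-map (suc m) (λ x → b2n (does (x ≟ c))) ⟩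
    ΣT (suc m) (λ x → b2n (does (x ≟ c))) ≡⟨ ΣF.FT-punch m c (λ x → b2n (does (x ≟ c))) ⟩
    b2n (does (c ≟ c)) + ΣT m (λ x → b2n (does (punchIn c x ≟ c)))
      ≡⟨ cong₂ _+_ (cong b2n (dec-true (c ≟ c) refl)) (trans (ΣF.FT-cong m (λ x → cong b2n (dec-false (punchIn c x ≟ c) (FP.punchInᵢ≢i c x)))) (ΣF.FT-ε m)) ⟩
    1 ∎

  _≟V_ : ∀ {m k} → (u w : Vec (Fin m) k) → Dec (u ≡ w)
  _≟V_ = VP.≡-dec _≟_

  ≟V-cons : ∀ {m k} (x y : Fin m) (u w : Vec (Fin m) k) → b2n (does ((x V.∷ u) ≟V (y V.∷ w))) ≡ b2n (does (x ≟ y)) * b2n (does (u ≟V w))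
  ≟V-cons x y u w = b2n-∧ (does (x ≟ y)) (does (u ≟V w))

  count-vecs : ∀ {m} k (u : Vec (Fin m) k) → LS (allVecs k (allFin m)) (λ w → b2n (does (w ≟V u))) ≡ 1
  count-vecs zero V.[] = refl
  count-vecs {m} (suc k) (c V.∷ u) = begin
    LS (allVecs (suc k) (allFin m)) (λ w → b2n (does (w ≟V (c V.∷ u))))
      ≡⟨ LS-concatMap (allFin m) _ _ ⟩
    LS (allFin m) (λ x → LS (map (x V.∷_) (allVecs k (allFin m))) (λ w → b2n (does (w ≟V (c V.∷ u)))))
      ≡⟨ LS-cong (allFin m) (λ x → trans (LS-map (allVecs k (allFin m)) (x V.∷_) _)
            (trans (LS-cong (allVecs k (allFin m)) (λ w → ≟V-cons x c w u)) (trans (LS-*ˡ (allVecs k (allFin m)) (b2n (does (x ≟ c))) _)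
               (trans (cong (b2n (does (x ≟ c)) *_) (count-vecs k u)) (ℕP.*-identityʳ _))))) ⟩
    LS (allFin m) (λ x → b2n (does (x ≟ c))) ≡⟨ count-allFin c ⟩
    1 ∎

  All-lookup : ∀ {A : Set} {P : A → Set} {k} (xs : Vec A k) → All P (toList xs) → ∀ j → P (lookup xs j)
  All-lookup (x V.∷ xs) (px ∷ pxs) F.zero = px
  All-lookup (x V.∷ xs) (px ∷ pxs) (F.suc j) = All-lookup xs pxs j

  lookup-All : ∀ {A : Set} {P : A → Set} {k} (xs : Vec A k) → (∀ j → P (lookup xs j)) → All P (toList xs)
  lookup-All V.[] f = []
  lookup-All (x V.∷ xs) f = f F.zero ∷ lookup-All xs (f ∘ F.suc)

  unique⇒inj : ∀ {m k} (σ : Vec (Fin m) k) → AllPairs (λ x y → ¬ x ≡ y) (toList σ) → ∀ i j → lookup σ i ≡ lookup σ j → i ≡ j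
  unique⇒inj (x V.∷ xs) (px ∷ ap) F.zero F.zero e = refl
  unique⇒inj (x V.∷ xs) (px ∷ ap) F.zero (F.suc j) e = ⊥-elim (All-lookup xs px j e)
  unique⇒inj (x V.∷ xs) (px ∷ ap) (F.suc i) F.zero e = ⊥-elim (All-lookup xs px i (sym e))
  unique⇒inj (x V.∷ xs) (px ∷ ap) (F.suc i) (F.suc j) e = cong F.suc (unique⇒inj xs ap i j e)

  inj⇒unique : ∀ {m k} (σ : Vec (Fin m) k) → (∀ i j → lookup σ i ≡ lookup σ j → i ≡ j) → AllPairs (λ x y → ¬ x ≡ y) (toList σ)
  inj⇒unique V.[] inj = []
  inj⇒unique (x V.∷ xs) inj = lookup-All xs (λ j e → case (inj F.zero (F.suc j) e)) ∷ inj⇒unique xs (λ i j e → FP.suc-injective (inj (F.suc i) (F.suc j) e))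
    where
    case : ∀ {k} {j : Fin k} → F.zero ≡ F.suc j → ⊥
    case ()

  uniq : ∀ {n} → Vec (Fin n) n → Bool
  uniq σ = does (unique? _≟_ (toList σ))

  uniq⇒inj : ∀ {n} (σ : Vec (Fin n) n) → uniq σ ≡ true → Inj (lookup σ)
  uniq⇒inj σ e = unique⇒inj σ (does-true (unique? _≟_ (toList σ)) e)

  inj⇒uniq : ∀ {n} (σ : Vec (Fin n) n) → Inj (lookup σ) → uniq σ ≡ true
  inj⇒uniq σ inj = dec-true (unique? _≟_ (toList σ)) (inj⇒unique σ inj)

  -- The permanent, on functional matrices; permanent M is definitionally per (entry M).
  per : ∀ {n} → Mat n → ℕ
  per {n} a = sum (map (λ σ → product (map (λ k → b2n (a (lookup σ k) k)) (allFin n))) (permutations n))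

  supported : ∀ {n} → Mat n → Vec (Fin n) n → Bool
  supported {n} a σ = uniq σ ∧ ∧T n (λ k → a (lookup σ k) k)

  words : (n : ℕ) → List (Vec (Fin n) n)
  words n = allVecs n (allFin n)

  per≡ : ∀ {n} (a : Mat n) → per a ≡ LS (words n) (λ σ → b2n (supported a σ))
  per≡ {n} a = trans (LS-filter uniq (words n) _) (LS-cong (words n) λ σ → step σ (uniq σ))
    where
    step : ∀ σ b → (if b then product (map (λ k → b2n (a (lookup σ k) k)) (allFin n)) else 0) ≡ b2n (b ∧ ∧T n (λ k → a (lookup σ k) k))
    step σ true = product-b2n (λ k → a (lookup σ k) k)
    step σ false = refl

  idWord : ∀ n → Vec (Fin n) n
  idWord n = V.tabulate id

  supported-idWord : ∀ {n} (a : Mat n) → (∀ k → a k k ≡ true) → supported a (idWord n) ≡ true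
  supported-idWord {n} a diag rewrite inj⇒uniq (idWord n) (λ i j e → trans (sym (VP.lookup∘tabulate id i)) (trans e (VP.lookup∘tabulate id j)))
    = ∧T-true⇐ n _ (λ k → subst (λ x → a x k ≡ true) (sym (VP.lookup∘tabulate id k)) (diag k))

  supported⇒ : ∀ {n} (a : Mat n) σ → supported a σ ≡ true → Inj (lookup σ) × Supp a (lookup σ)
  supported⇒ {n} a σ e = uniq⇒inj σ (BP.∧-conicalˡ (uniq σ) _ e) , ∧T-true⇒ n _ (BP.∧-conicalʳ (uniq σ) _ e)

  ⇒supported : ∀ {n} (a : Mat n) σ → Inj (lookup σ) → Supp a (lookup σ) → supported a σ ≡ true
  ⇒supported {n} a σ inj sp rewrite inj⇒uniq σ inj = ∧T-true⇐ n _ sp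

  OnlyIdentity⇒per≡1 : ∀ {n} (a : Mat n) → (∀ k → a k k ≡ true) → OnlyIdentity a → per a ≡ 1
  OnlyIdentity⇒per≡1 {n} a diag only = trans (per≡ a) (trans (LS-cong (words n) indicator) (count-vecs n (idWord n)))
    where
    indicator : ∀ σ → b2n (supported a σ) ≡ b2n (does (σ ≟V idWord n))
    indicator σ with supported a σ in eq
    ... | true = sym (cong b2n (dec-true (σ ≟V idWord n) σ≡))
      where
      σ≡ : σ ≡ idWord n
      σ≡ = trans (sym (VP.tabulate∘lookup σ)) (VP.tabulate-cong (only (lookup σ) (proj₁ (supported⇒ a σ eq)) (proj₂ (supported⇒ a σ eq))))
    ... | false = sym (cong b2n (dec-false (σ ≟V idWord n) (λ e → case (trans (sym eq) (trans (cong (supported a) e) (supported-idWord a diag))))))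
      where
      case : false ≡ true → ⊥
      case ()

  -- Conversely, a supported non-identity permutation would be a second counted word.
  per≡1⇒OnlyIdentity : ∀ {n} (a : Mat n) → (∀ k → a k k ≡ true) → per a ≡ 1 → OnlyIdentity a
  per≡1⇒OnlyIdentity {n} a diag pe σf inj sp k with FP.all? (λ k → σf k ≟ k)
  ... | yes all = all k
  ... | no ¬all = ⊥-elim (ℕP.<⇒≱ (ℕP.≤-reflexive refl) (ℕP.≤-trans two (ℕP.≤-reflexive (trans (sym (per≡ a)) pe))))
    where
    w : Vec (Fin n) n
    w = V.tabulate σf
    w≢ : ¬ w ≡ idWord n
    w≢ e = ¬all (λ j → trans (sym (VP.lookup∘tabulate σf j)) (trans (cong (λ v → lookup v j) e) (VP.lookup∘tabulate id j)))
    supported-w : supported a w ≡ true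
    supported-w = ⇒supported a w (λ i j e → inj i j (trans (sym (VP.lookup∘tabulate σf i)) (trans e (VP.lookup∘tabulate σf j))))
                   (λ j → subst (λ x → a x j ≡ true) (sym (VP.lookup∘tabulate σf j)) (sp j))
    two-indicators : ∀ x → b2n (does (x ≟V idWord n)) + b2n (does (x ≟V w)) ≤ b2n (supported a x)
    two-indicators x with x ≟V idWord n | x ≟V w
    ... | yes e1 | yes e2 = ⊥-elim (w≢ (trans (sym e2) e1))
    ... | yes refl | no _ = ℕP.≤-reflexive (cong b2n (sym (supported-idWord a diag)))
    ... | no _ | yes refl = ℕP.≤-reflexive (cong b2n (sym supported-w))
    ... | no _ | no _ = z≤n
    two : 2 ≤ LS (words n) (λ σ → b2n (supported a σ))
    two = ℕP.≤-trans (ℕP.≤-reflexive (sym (trans (LS-+ (words n) _ _) (cong₂ _+_ (count-vecs n (idWord n)) (count-vecs n w)))))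
                     (LS-mono (words n) two-indicators)

module ListSums where

  open import Data.Bool using (Bool; true; false)
  open import Data.Nat using (suc)
  open import Data.Rational using (ℚ; 0ℚ; _+_; _*_; -_)
  open import Data.Rational.Properties
  open import Algebra.Bundles using (CommutativeMonoid)
  open import Algebra.Properties.CommutativeSemigroup
    (CommutativeMonoid.commutativeSemigroup +-0-commutativeMonoid) using (interchange)
  open import Data.List using (List; []; _∷_; map; concatMap; _++_)
  open import Data.Vec as V using (Vec)
  open import Function using (_∘_)
  open import Relation.Binary.PropositionalEquality
  open ≡-Reasoning
  open PowerSeries

  ΣQ : ∀ {A : Set} → List A → (A → ℚ) → ℚ
  ΣQ [] f = 0ℚ
  ΣQ (x ∷ xs) f = f x + ΣQ xs f

  ΣQ-cong : ∀ {A : Set} (xs : List A) {f g : A → ℚ} → (∀ x → f x ≡ g x) → ΣQ xs f ≡ ΣQ xs g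
  ΣQ-cong [] e = refl
  ΣQ-cong (x ∷ xs) e = cong₂ _+_ (e x) (ΣQ-cong xs e)

  ΣQ-++ : ∀ {A : Set} (xs ys : List A) f → ΣQ (xs ++ ys) f ≡ ΣQ xs f + ΣQ ys f
  ΣQ-++ [] ys f = sym (+-identityˡ (ΣQ ys f))
  ΣQ-++ (x ∷ xs) ys f = trans (cong (f x +_) (ΣQ-++ xs ys f)) (sym (+-assoc (f x) (ΣQ xs f) (ΣQ ys f)))

  ΣQ-map : ∀ {A B : Set} (xs : List A) (h : A → B) f → ΣQ (map h xs) f ≡ ΣQ xs (f ∘ h)
  ΣQ-map [] h f = refl
  ΣQ-map (x ∷ xs) h f = cong (f (h x) +_) (ΣQ-map xs h f)

  ΣQ-concatMap : ∀ {A B : Set} (xs : List A) (g : A → List B) f → ΣQ (concatMap g xs) f ≡ ΣQ xs (λ x → ΣQ (g x) f)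
  ΣQ-concatMap [] g f = refl
  ΣQ-concatMap (x ∷ xs) g f = trans (ΣQ-++ (g x) (concatMap g xs) f) (cong (ΣQ (g x) f +_) (ΣQ-concatMap xs g f))

  ΣQ-+ : ∀ {A : Set} (xs : List A) f g → ΣQ xs (λ x → f x + g x) ≡ ΣQ xs f + ΣQ xs g
  ΣQ-+ [] f g = sym (+-identityˡ 0ℚ)
  ΣQ-+ (x ∷ xs) f g = trans (cong (f x + g x +_) (ΣQ-+ xs f g)) (interchange (f x) (g x) (ΣQ xs f) (ΣQ xs g))

  ΣQ-*ˡ : ∀ {A : Set} (xs : List A) c f → ΣQ xs (λ x → c * f x) ≡ c * ΣQ xs f
  ΣQ-*ˡ [] c f = sym (*-zeroʳ c)
  ΣQ-*ˡ (x ∷ xs) c f = trans (cong (c * f x +_) (ΣQ-*ˡ xs c f)) (sym (*-distribˡ-+ c (f x) (ΣQ xs f)))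

  ΣQ-0 : ∀ {A : Set} (xs : List A) → ΣQ xs (λ _ → 0ℚ) ≡ 0ℚ
  ΣQ-0 [] = refl
  ΣQ-0 (x ∷ xs) = trans (+-identityˡ _) (ΣQ-0 xs)

  ΣQ-neg : ∀ {A : Set} (xs : List A) f → ΣQ xs (λ x → - f x) ≡ - ΣQ xs f
  ΣQ-neg [] f = refl
  ΣQ-neg (x ∷ xs) f = trans (cong (- f x +_) (ΣQ-neg xs f)) (sym (neg-distrib-+ (f x) (ΣQ xs f)))

  ΣQ-*ʳ : ∀ {A : Set} (xs : List A) c f → ΣQ xs (λ x → f x * c) ≡ ΣQ xs f * c
  ΣQ-*ʳ xs c f = trans (ΣQ-cong xs (λ x → *-comm (f x) c)) (trans (ΣQ-*ˡ xs c f) (*-comm c (ΣQ xs f)))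

  ΣQ-swap : ∀ {A B : Set} (xs : List A) (ys : List B) (h : A → B → ℚ) →
    ΣQ xs (λ x → ΣQ ys (h x)) ≡ ΣQ ys (λ y → ΣQ xs (λ x → h x y))
  ΣQ-swap [] ys h = sym (ΣQ-0 ys)
  ΣQ-swap (x ∷ xs) ys h = trans (cong (ΣQ ys (h x) +_) (ΣQ-swap xs ys h)) (sym (ΣQ-+ ys (h x) (λ y → ΣQ xs (λ x → h x y))))

  ΣL : ∀ {A : Set} → List A → (A → PS) → PS
  ΣL xs f j = ΣQ xs (λ x → f x j)

  ΣL-⊛ : ∀ {A : Set} (xs : List A) (F : A → PS) G → (ΣL xs F ⊛ G) ≗ₚ ΣL xs (λ x → F x ⊛ G)
  ΣL-⊛ [] F G j = trans (⊛-comm zeroPS G j) (⊛-zero G j)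
  ΣL-⊛ (x ∷ xs) F G j = trans (⊛-distribʳ (F x) (ΣL xs F) G j) (cong ((F x ⊛ G) j +_) (ΣL-⊛ xs F G j))

  ΣL-0 : ∀ {A : Set} (xs : List A) → ΣL xs (λ _ → zeroPS) ≗ₚ zeroPS
  ΣL-0 xs j = ΣQ-0 xs

  ΣL-⊛ˡ : ∀ {A : Set} (xs : List A) (F : A → PS) G → (G ⊛ ΣL xs F) ≗ₚ ΣL xs (λ x → G ⊛ F x)
  ΣL-⊛ˡ xs F G j = trans (⊛-comm G (ΣL xs F) j) (trans (ΣL-⊛ xs F G j) (ΣQ-cong xs (λ x → ⊛-comm (F x) G j)))

  bools : List Bool
  bools = true ∷ false ∷ []

  ΣQ-allVecs-suc : ∀ {B : Set} (ys : List B) K (h : Vec B (suc K) → ℚ) →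
    ΣQ (allVecs (suc K) ys) h ≡ ΣQ ys (λ y → ΣQ (allVecs K ys) (λ w → h (y V.∷ w)))
  ΣQ-allVecs-suc ys K h = trans (ΣQ-concatMap ys (λ y → map (y V.∷_) (allVecs K ys)) h) (ΣQ-cong ys (λ y → ΣQ-map (allVecs K ys) (y V.∷_) h))

  ΣQ-vec : ∀ k (f : Vec Bool (suc k) → ℚ) →
    ΣQ (allVecs (suc k) bools) f ≡ ΣQ (allVecs k bools) (λ r → f (true V.∷ r)) + ΣQ (allVecs k bools) (λ r → f (false V.∷ r))
  ΣQ-vec k f = trans (ΣQ-allVecs-suc bools k f) (cong (ΣQ (allVecs k bools) (λ r → f (true V.∷ r)) +_) (+-identityʳ _))

  ΣL-vec : ∀ k (F : Vec Bool (suc k) → PS) → ΣL (allVecs (suc k) bools) F ≗ₚ (ΣL (allVecs k bools) (λ r → F (true V.∷ r)) ⊕ ΣL (allVecs k bools) (λ r → F (false V.∷ r)))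
  ΣL-vec k F j = ΣQ-vec k (λ r → F r j)

-- The key fact
-- is sum-avoiding: summing t^(ones r) over the 0/1 vectors r vanishing on S gives
-- (1+t)^(number of zeros of S) — each free position contributes 1 + t.
module Indicators where

  open import Data.Bool using (Bool; true; false; if_then_else_; not)
  open import Data.Nat as ℕ using (zero; suc; _∸_; _≡ᵇ_)
  open import Data.Rational using (ℚ; 0ℚ; 1ℚ; _+_; _*_)
  open import Data.Rational.Properties
  open import Data.List using (List; []; _∷_; filterᵇ; length)
  open import Data.Vec as V using (Vec; lookup)
  open import Relation.Binary.PropositionalEquality
  open ≡-Reasoning
  open PowerSeries
  open NatToRational using (ℕtoℚ-+)
  open ListSums
  open MatrixStatistics using (ΣT; ∧T)

  tPS : PS
  tPS zero = 0ℚ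
  tPS (suc zero) = 1ℚ
  tPS (suc (suc _)) = 0ℚ

  tPS⊛ : ∀ F j → (tPS ⊛ F) (suc j) ≡ F j
  tPS⊛ F zero = begin
    (tPS ⊛ F) 1 ≡⟨ sumUpTo-shift 0 (λ i → tPS i * F (1 ∸ i)) ⟩
    0ℚ * F 1 + 1ℚ * F 0 ≡⟨ cong₂ _+_ (*-zeroˡ (F 1)) (*-identityˡ (F 0)) ⟩
    0ℚ + F 0 ≡⟨ +-identityˡ (F 0) ⟩
    F 0 ∎
  tPS⊛ F (suc j) = begin
    (tPS ⊛ F) (suc (suc j)) ≡⟨ sumUpTo-shift (suc j) (λ i → tPS i * F (suc (suc j) ∸ i)) ⟩
    0ℚ * F (suc (suc j)) + sumUpTo (suc j) (λ i → tPS (suc i) * F (suc j ∸ i)) ≡⟨ cong₂ _+_ (*-zeroˡ (F (suc (suc j)))) (sumUpTo-shift j (λ i → tPS (suc i) * F (suc j ∸ i))) ⟩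
    0ℚ + (1ℚ * F (suc j) + sumUpTo j (λ i → 0ℚ * F (j ∸ i))) ≡⟨ +-identityˡ _ ⟩
    1ℚ * F (suc j) + sumUpTo j (λ i → 0ℚ * F (j ∸ i)) ≡⟨ cong₂ _+_ (*-identityˡ (F (suc j))) (trans (sumUpTo-cong j (λ i _ → *-zeroˡ (F (j ∸ i)))) (sumUpTo-0 j)) ⟩
    F (suc j) + 0ℚ ≡⟨ +-identityʳ (F (suc j)) ⟩
    F (suc j) ∎

  tPS⊛0 : ∀ F → (tPS ⊛ F) 0 ≡ 0ℚ
  tPS⊛0 F = *-zeroˡ (F 0)

  mono : ℕ → PS
  mono e = tPS ^ₚ e

  mono-coeff : ∀ e j → mono e j ≡ ℕtoℚ (b2n (e ≡ᵇ j))
  mono-coeff zero zero = refl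
  mono-coeff zero (suc j) = refl
  mono-coeff (suc e) zero = tPS⊛0 (mono e)
  mono-coeff (suc e) (suc j) = trans (tPS⊛ (mono e) j) (mono-coeff e j)

  mono-+ : ∀ x y → mono (x ℕ.+ y) ≗ₚ (mono x ⊛ mono y)
  mono-+ x y = ^ₚ-+ tPS x y

  P≗1+tPS : P ≗ₚ (onePS ⊕ tPS)
  P≗1+tPS zero = sym (+-identityʳ 1ℚ)
  P≗1+tPS (suc zero) = sym (+-identityˡ 1ℚ)
  P≗1+tPS (suc (suc j)) = sym (+-identityˡ 0ℚ)

  ifP : Bool → PS → PS
  ifP true F = F
  ifP false F = zeroPS

  ifP-⊛ : ∀ b F G → (ifP b F ⊛ G) ≗ₚ ifP b (F ⊛ G)
  ifP-⊛ true F G j = refl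
  ifP-⊛ false F G j = trans (⊛-comm zeroPS G j) (⊛-zero G j)

  ifP-cong : ∀ b {X Y} → X ≗ₚ Y → ifP b X ≗ₚ ifP b Y
  ifP-cong true e = e
  ifP-cong false e j = refl

  b2q : Bool → ℚ
  b2q b = ℕtoℚ (b2n b)

  ifP-mult : ∀ b X j → ifP b X j ≡ b2q b * X j
  ifP-mult true X j = sym (*-identityˡ (X j))
  ifP-mult false X j = sym (*-zeroˡ (X j))

  length-filter : ∀ {X : Set} (p : X → Bool) (xs : List X) → ℕtoℚ (length (filterᵇ p xs)) ≡ ΣQ xs (λ x → b2q (p x))
  length-filter p [] = refl
  length-filter p (x ∷ xs) with p x
  ... | true = trans (ℕtoℚ-+ 1 (length (filterᵇ p xs))) (cong (1ℚ +_) (length-filter p xs))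
  ... | false = trans (length-filter p xs) (sym (+-identityˡ _))

  ones : ∀ {k} → Vec Bool k → ℕ
  ones {k} r = ΣT k (λ i → b2n (lookup r i))

  avoids : ∀ {k} → Vec Bool k → Vec Bool k → Bool
  avoids {k} S r = ∧T k (λ i → if lookup S i then not (lookup r i) else true)

  zeros : ∀ {k} → Vec Bool k → ℕ
  zeros {k} S = ΣT k (λ i → b2n (not (lookup S i)))

  sum-avoiding : ∀ k (S : Vec Bool k) → ΣL (allVecs k bools) (λ r → ifP (avoids S r) (mono (ones r))) ≗ₚ (P ^ₚ zeros S)
  sum-avoiding zero V.[] j = +-identityʳ (onePS j)
  sum-avoiding (suc k) (true V.∷ S) j = begin
    ΣL (allVecs (suc k) bools) (λ r → ifP (avoids (true V.∷ S) r) (mono (ones r))) j ≡⟨ ΣL-vec k (λ r → ifP (avoids (true V.∷ S) r) (mono (ones r))) j ⟩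
    ΣL (allVecs k bools) (λ r → zeroPS) j + ΣL (allVecs k bools) (λ r → ifP (avoids S r) (mono (ones r))) j
      ≡⟨ cong₂ _+_ (ΣL-0 (allVecs k bools) j) (sum-avoiding k S j) ⟩
    0ℚ + (P ^ₚ zeros S) j ≡⟨ +-identityˡ _ ⟩
    (P ^ₚ zeros S) j ∎
  sum-avoiding (suc k) (false V.∷ S) j = begin
    ΣL (allVecs (suc k) bools) (λ r → ifP (avoids (false V.∷ S) r) (mono (ones r))) j ≡⟨ ΣL-vec k (λ r → ifP (avoids (false V.∷ S) r) (mono (ones r))) j ⟩
    ΣL (allVecs k bools) (λ r → ifP (avoids S r) (tPS ⊛ mono (ones r))) j + rest j
      ≡⟨ cong (_+ rest j) (ΣQ-cong (allVecs k bools) (λ r → sym (t-ifP (avoids S r) (mono (ones r)) j))) ⟩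
    ΣL (allVecs k bools) (λ r → tPS ⊛ ifP (avoids S r) (mono (ones r))) j + rest j
      ≡⟨ cong (_+ rest j) (sym (ΣL-⊛ˡ (allVecs k bools) (λ r → ifP (avoids S r) (mono (ones r))) tPS j)) ⟩
    (tPS ⊛ rest) j + rest j ≡⟨ cong ((tPS ⊛ rest) j +_) (sym (⊛-identityˡ rest j)) ⟩
    (tPS ⊛ rest) j + (onePS ⊛ rest) j ≡⟨ +-comm ((tPS ⊛ rest) j) ((onePS ⊛ rest) j) ⟩
    (onePS ⊛ rest) j + (tPS ⊛ rest) j ≡⟨ sym (⊛-distribʳ onePS tPS rest j) ⟩
    ((onePS ⊕ tPS) ⊛ rest) j ≡⟨ ⊛-cong (λ i → sym (P≗1+tPS i)) (sum-avoiding k S) j ⟩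
    (P ^ₚ zeros (false V.∷ S)) j ∎
    where
    rest : PS
    rest = ΣL (allVecs k bools) (λ r → ifP (avoids S r) (mono (ones r)))
    t-ifP : ∀ b F → (tPS ⊛ ifP b F) ≗ₚ ifP b (tPS ⊛ F)
    t-ifP b F i = trans (⊛-comm tPS (ifP b F) i) (trans (ifP-⊛ b F tPS i) (ifP-cong b (⊛-comm F tPS) i))

module MatrixEnumeration where

  open import Data.Bool using (Bool)
  open import Data.Nat using (zero; suc)
  open import Data.Rational using (ℚ; 0ℚ; _+_)
  open import Data.Rational.Properties using (+-identityʳ)
  open import Data.Fin as F using (Fin; punchIn)
  open import Data.List using (List)
  open import Data.Vec as V using (Vec; lookup; insertAt; zipWith)
  import Data.Vec.Properties as VP
  open import Relation.Binary.PropositionalEquality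
  open ≡-Reasoning
  open ListSums

  ΣQ-insertAt : ∀ {A : Set} n (xs : List A) (v : Fin (suc n)) (f : Vec A (suc n) → ℚ) →
    ΣQ (allVecs (suc n) xs) f ≡ ΣQ xs (λ x → ΣQ (allVecs n xs) (λ w → f (insertAt w v x)))
  ΣQ-insertAt n xs F.zero f = ΣQ-allVecs-suc xs n f
  ΣQ-insertAt (suc n) xs (F.suc v) f = begin
    ΣQ (allVecs (suc (suc n)) xs) f
      ≡⟨ ΣQ-allVecs-suc xs (suc n) f ⟩
    ΣQ xs (λ y → ΣQ (allVecs (suc n) xs) (λ w → f (y V.∷ w)))
      ≡⟨ ΣQ-cong xs (λ y → ΣQ-insertAt n xs v (λ w → f (y V.∷ w))) ⟩
    ΣQ xs (λ y → ΣQ xs (λ x → ΣQ (allVecs n xs) (λ w → f (y V.∷ insertAt w v x))))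
      ≡⟨ ΣQ-swap xs xs (λ y x → ΣQ (allVecs n xs) (λ w → f (y V.∷ insertAt w v x))) ⟩
    ΣQ xs (λ x → ΣQ xs (λ y → ΣQ (allVecs n xs) (λ w → f (insertAt (y V.∷ w) (F.suc v) x))))
      ≡⟨ ΣQ-cong xs (λ x → sym (ΣQ-allVecs-suc xs n (λ w → f (insertAt w (F.suc v) x)))) ⟩
    ΣQ xs (λ x → ΣQ (allVecs (suc n) xs) (λ w → f (insertAt w (F.suc v) x))) ∎

  insertColumn : ∀ {A : Set} {K n} → Fin (suc n) → Vec (Vec A n) K → Vec A K → Vec (Vec A (suc n)) K
  insertColumn v R c = zipWith (λ row x → insertAt row v x) R c

  ΣQ-insertColumn : ∀ {A : Set} K n (xs : List A) (v : Fin (suc n)) (g : Vec (Vec A (suc n)) K → ℚ) →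
    ΣQ (allVecs K (allVecs (suc n) xs)) g ≡ ΣQ (allVecs K (allVecs n xs)) (λ R → ΣQ (allVecs K xs) (λ c → g (insertColumn v R c)))
  ΣQ-insertColumn zero n xs v g = sym (+-identityʳ (g V.[] + 0ℚ))
  ΣQ-insertColumn (suc K) n xs v g = begin
    ΣQ (allVecs (suc K) (allVecs (suc n) xs)) g
      ≡⟨ ΣQ-allVecs-suc (allVecs (suc n) xs) K g ⟩
    ΣQ (allVecs (suc n) xs) (λ row → ΣQ (allVecs K (allVecs (suc n) xs)) (λ R → g (row V.∷ R)))
      ≡⟨ ΣQ-insertAt n xs v (λ row → ΣQ (allVecs K (allVecs (suc n) xs)) (λ R → g (row V.∷ R))) ⟩
    ΣQ xs (λ x → ΣQ (allVecs n xs) (λ row → ΣQ (allVecs K (allVecs (suc n) xs)) (λ R → g (insertAt row v x V.∷ R))))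
      ≡⟨ ΣQ-cong xs (λ x → ΣQ-cong (allVecs n xs) (λ row → ΣQ-insertColumn K n xs v (λ R → g (insertAt row v x V.∷ R)))) ⟩
    ΣQ xs (λ x → ΣQ (allVecs n xs) (λ row → ΣQ (allVecs K (allVecs n xs)) (λ R → ΣQ (allVecs K xs) (λ c → g (insertAt row v x V.∷ insertColumn v R c)))))
      ≡⟨ ΣQ-swap xs (allVecs n xs) (λ x row → ΣQ (allVecs K (allVecs n xs)) (λ R → ΣQ (allVecs K xs) (λ c → g (insertAt row v x V.∷ insertColumn v R c)))) ⟩
    ΣQ (allVecs n xs) (λ row → ΣQ xs (λ x → ΣQ (allVecs K (allVecs n xs)) (λ R → ΣQ (allVecs K xs) (λ c → g (insertAt row v x V.∷ insertColumn v R c)))))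
      ≡⟨ ΣQ-cong (allVecs n xs) (λ row → ΣQ-swap xs (allVecs K (allVecs n xs)) (λ x R → ΣQ (allVecs K xs) (λ c → g (insertAt row v x V.∷ insertColumn v R c)))) ⟩
    ΣQ (allVecs n xs) (λ row → ΣQ (allVecs K (allVecs n xs)) (λ R → ΣQ xs (λ x → ΣQ (allVecs K xs) (λ c → g (insertColumn v (row V.∷ R) (x V.∷ c))))))
      ≡⟨ ΣQ-cong (allVecs n xs) (λ row → ΣQ-cong (allVecs K (allVecs n xs)) (λ R → sym (ΣQ-allVecs-suc xs K (λ c → g (insertColumn v (row V.∷ R) c))))) ⟩
    ΣQ (allVecs n xs) (λ row → ΣQ (allVecs K (allVecs n xs)) (λ R → ΣQ (allVecs (suc K) xs) (λ c → g (insertColumn v (row V.∷ R) c))))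
      ≡⟨ sym (ΣQ-allVecs-suc (allVecs n xs) K (λ R → ΣQ (allVecs (suc K) xs) (λ c → g (insertColumn v R c)))) ⟩
    ΣQ (allVecs (suc K) (allVecs n xs)) (λ R → ΣQ (allVecs (suc K) xs) (λ c → g (insertColumn v R c))) ∎

  extend : ∀ {n} → Fin (suc n) → Matrix n → Vec Bool n → Vec Bool n → Bool → Matrix (suc n)
  extend v M r c d = insertAt (insertColumn v M c) v (insertAt r v d)

  ΣQ-extend : ∀ n (v : Fin (suc n)) (f : Matrix (suc n) → ℚ) →
    ΣQ (allMatrices (suc n)) f ≡ ΣQ (allMatrices n) (λ M → ΣQ (allVecs n bools) (λ r → ΣQ (allVecs n bools) (λ c → ΣQ bools (λ d → f (extend v M r c d)))))
  ΣQ-extend n v f = begin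
    ΣQ (allMatrices (suc n)) f
      ≡⟨ ΣQ-insertAt n (allVecs (suc n) bools) v f ⟩
    ΣQ (allVecs (suc n) bools) (λ rv → ΣQ (allVecs n (allVecs (suc n) bools)) (λ R → f (insertAt R v rv)))
      ≡⟨ ΣQ-cong (allVecs (suc n) bools) (λ rv → ΣQ-insertColumn n n bools v (λ R → f (insertAt R v rv))) ⟩
    ΣQ (allVecs (suc n) bools) (λ rv → ΣQ (allMatrices n) (λ M → ΣQ (allVecs n bools) (λ c → f (insertAt (insertColumn v M c) v rv))))
      ≡⟨ ΣQ-insertAt n bools v (λ rv → ΣQ (allMatrices n) (λ M → ΣQ (allVecs n bools) (λ c → f (insertAt (insertColumn v M c) v rv)))) ⟩
    ΣQ bools (λ d → ΣQ (allVecs n bools) (λ r → ΣQ (allMatrices n) (λ M → ΣQ (allVecs n bools) (λ c → f (extend v M r c d)))))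
      ≡⟨ ΣQ-cong bools (λ d → ΣQ-swap (allVecs n bools) (allMatrices n) (λ r M → ΣQ (allVecs n bools) (λ c → f (extend v M r c d)))) ⟩
    ΣQ bools (λ d → ΣQ (allMatrices n) (λ M → ΣQ (allVecs n bools) (λ r → ΣQ (allVecs n bools) (λ c → f (extend v M r c d)))))
      ≡⟨ ΣQ-swap bools (allMatrices n) (λ d M → ΣQ (allVecs n bools) (λ r → ΣQ (allVecs n bools) (λ c → f (extend v M r c d)))) ⟩
    ΣQ (allMatrices n) (λ M → ΣQ bools (λ d → ΣQ (allVecs n bools) (λ r → ΣQ (allVecs n bools) (λ c → f (extend v M r c d)))))
      ≡⟨ ΣQ-cong (allMatrices n) (λ M → ΣQ-swap bools (allVecs n bools) (λ d r → ΣQ (allVecs n bools) (λ c → f (extend v M r c d)))) ⟩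
    ΣQ (allMatrices n) (λ M → ΣQ (allVecs n bools) (λ r → ΣQ bools (λ d → ΣQ (allVecs n bools) (λ c → f (extend v M r c d)))))
      ≡⟨ ΣQ-cong (allMatrices n) (λ M → ΣQ-cong (allVecs n bools) (λ r → ΣQ-swap bools (allVecs n bools) (λ d c → f (extend v M r c d)))) ⟩
    ΣQ (allMatrices n) (λ M → ΣQ (allVecs n bools) (λ r → ΣQ (allVecs n bools) (λ c → ΣQ bools (λ d → f (extend v M r c d))))) ∎

  extend-vv : ∀ {n} (v : Fin (suc n)) M r c d → entry (extend v M r c d) v v ≡ d
  extend-vv v M r c d = trans (cong (λ row → lookup row v) (VP.insertAt-lookup (insertColumn v M c) v (insertAt r v d))) (VP.insertAt-lookup r v d)

  extend-vk : ∀ {n} (v : Fin (suc n)) M r c d k → entry (extend v M r c d) v (punchIn v k) ≡ lookup r k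
  extend-vk v M r c d k = trans (cong (λ row → lookup row (punchIn v k)) (VP.insertAt-lookup (insertColumn v M c) v (insertAt r v d))) (VP.insertAt-punchIn r v d k)

  extend-row : ∀ {n} (v : Fin (suc n)) M r c d i → lookup (extend v M r c d) (punchIn v i) ≡ insertAt (lookup M i) v (lookup c i)
  extend-row v M r c d i = trans (VP.insertAt-punchIn (insertColumn v M c) v (insertAt r v d) i) (VP.lookup-zipWith (λ row x → insertAt row v x) i M c)

  extend-iv : ∀ {n} (v : Fin (suc n)) M r c d i → entry (extend v M r c d) (punchIn v i) v ≡ lookup c i
  extend-iv v M r c d i = trans (cong (λ row → lookup row v) (extend-row v M r c d i)) (VP.insertAt-lookup (lookup M i) v (lookup c i))

  extend-ik : ∀ {n} (v : Fin (suc n)) M r c d i k → entry (extend v M r c d) (punchIn v i) (punchIn v k) ≡ entry M i k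
  extend-ik v M r c d i k = trans (cong (λ row → lookup row (punchIn v k)) (extend-row v M r c d i)) (VP.insertAt-punchIn (lookup M i) v (lookup c i) k)

-- A matrix is valid if its diagonal is all ones and its
-- permanent is 1; its weight is t^(number of off-diagonal ones) if valid and 0 otherwise,
-- and HPS N is the total weight of the N×N matrices, so [tᵉ] HPS N = H N e.
module ValidMatrices where

  open import Data.Bool using (Bool; true; false; if_then_else_; _∧_; not; T)
  open import Data.Nat using (zero; suc; _≡ᵇ_)
  import Data.Nat.Properties as ℕP
  import Data.Bool.Properties as BP
  open import Data.Fin using (Fin; _≟_)
  open import Data.List using (allFin)
  import Data.List.Properties as LP
  open import Data.Nat.ListAction using (sum; product)
  open import Data.Vec using (lookup)
  open import Data.Unit using (tt)
  open import Data.Empty using (⊥-elim)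
  open import Function using (_∘_)
  open import Relation.Nullary using (yes; no; does)
  open import Relation.Nullary.Decidable using (dec-false)
  open import Relation.Binary.PropositionalEquality
  open PowerSeries
  open ListSums
  open Indicators
  open MatrixStatistics
  open IdentityOnly
  open PermanentOne

  valid : ∀ {n} → Mat n → Bool
  valid a = diagT a ∧ (per a ≡ᵇ 1)

  weight : ∀ {n} → Mat n → PS
  weight a = ifP (valid a) (mono (offT a))

  HPS : ℕ → PS
  HPS N = ΣL (allMatrices N) (weight ∘ entry)

  ≡ᵇ1-cong : ∀ x y → (x ≡ 1 → y ≡ 1) → (y ≡ 1 → x ≡ 1) → (x ≡ᵇ 1) ≡ (y ≡ᵇ 1)
  ≡ᵇ1-cong x y f g with x ≡ᵇ 1 in e1 | y ≡ᵇ 1 in e2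
  ... | true | true = refl
  ... | false | false = refl
  ... | true | false = ⊥-elim (subst T e2 (ℕP.≡⇒≡ᵇ y 1 (f (ℕP.≡ᵇ⇒≡ x 1 (subst T (sym e1) tt)))))
  ... | false | true = ⊥-elim (subst T e1 (ℕP.≡⇒≡ᵇ x 1 (g (ℕP.≡ᵇ⇒≡ y 1 (subst T (sym e2) tt)))))

  not-true : ∀ b → not b ≡ true → b ≡ false
  not-true false _ = refl

  sinkᵇ⇒Sink : ∀ {n} (a : Mat n) v → sinkᵇ a v ≡ true → Sink a v
  sinkᵇ⇒Sink {n} a v e i ne = not-true (a i v) (subst (λ x → (if x then true else not (a i v)) ≡ true) (dec-false (i ≟ v) ne) (∧T-true⇒ n _ e i))

  Sink⇒sinkᵇ : ∀ {n} (a : Mat n) v → Sink a v → sinkᵇ a v ≡ true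
  Sink⇒sinkᵇ {n} a v sk = ∧T-true⇐ n _ entry-test
    where
    entry-test : ∀ i → (if does (i ≟ v) then true else not (a i v)) ≡ true
    entry-test i with i ≟ v
    ... | yes _ = refl
    ... | no ne rewrite sk i ne = refl

  diag⇒ : ∀ {n} (a : Mat n) → diagT a ≡ true → ∀ k → a k k ≡ true
  diag⇒ {n} a e = ∧T-true⇒ n (λ k → a k k) e

  valid-punch : ∀ {n} (v : Fin (suc n)) (a : Mat (suc n)) → sinkᵇ a v ≡ true → valid a ≡ a v v ∧ valid (minor v a)
  valid-punch {n} v a sink rewrite diagT-punch v a with a v v in avv
  ... | false = refl
  ... | true with diagT (minor v a) in dm
  ...   | false = refl
  ...   | true = ≡ᵇ1-cong (per a) (per (minor v a))
                 (λ pa → OnlyIdentity⇒per≡1 (minor v a) (diag⇒ (minor v a) dm) (OnlyIdentity-minor v a avv (per≡1⇒OnlyIdentity a dg pa)))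
                 (λ pm → OnlyIdentity⇒per≡1 a dg (OnlyIdentity-extend v a (sinkᵇ⇒Sink a v sink) (per≡1⇒OnlyIdentity (minor v a) (diag⇒ (minor v a) dm) pm)))
    where
    dg : ∀ k → a k k ≡ true
    dg = diag⇒ a (trans (diagT-punch v a) (trans (cong (_∧ diagT (minor v a)) avv) dm))

  per-cong : ∀ {n} {a b : Mat n} → (∀ i k → a i k ≡ b i k) → per a ≡ per b
  per-cong {n} e = cong sum (LP.map-cong (λ σ → cong product (LP.map-cong (λ k → cong b2n (e (lookup σ k) k)) (allFin n))) (permutations n))

  valid-cong : ∀ {n} {a b : Mat n} → (∀ i k → a i k ≡ b i k) → valid a ≡ valid b
  valid-cong e = cong₂ _∧_ (diagT-cong e) (cong (_≡ᵇ 1) (per-cong e))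

  coefficient-indicator : ∀ d o e p → b2q (d ∧ (o ≡ᵇ e) ∧ p) ≡ ifP (d ∧ p) (mono o) e
  coefficient-indicator false o e p = refl
  coefficient-indicator true o e true = trans (cong b2q (BP.∧-identityʳ (o ≡ᵇ e))) (sym (mono-coeff o e))
  coefficient-indicator true o e false = cong b2q (BP.∧-zeroʳ (o ≡ᵇ e))

  H≡HPS : ∀ n e → ℕtoℚ (H n e) ≡ HPS n e
  H≡HPS n e = trans (length-filter _ (allMatrices n))
    (ΣQ-cong (allMatrices n) (λ M → trans (cong₂ (λ d o → b2q (d ∧ (o ≡ᵇ e) ∧ (permanent M ≡ᵇ 1))) (diag≡ M) (offDiag≡ M))
                                          (coefficient-indicator (diagT (entry M)) (offT (entry M)) e (per (entry M) ≡ᵇ 1))))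

  HPS-zero : HPS 0 ≗ₚ onePS
  HPS-zero zero = refl
  HPS-zero (suc e) = refl

-- Removing one v ∈ S: the minor
-- at v ranges over the matrices with S∖{v} as sinks, column v is zero, the entry (v,v)
-- must be 1, and row v is free except on S∖{v}, contributing (1+t)^(zeros of S∖{v})
-- (sinkSum-remove).
module SinkRemoval where

  open import Data.Bool using (Bool; true; false; if_then_else_; _∧_; not)
  import Data.Bool.Properties as BP
  open import Data.Nat as ℕ using (zero; suc; _∸_)
  import Data.Nat.Properties as ℕP
  open import Data.Rational using (0ℚ; _+_)
  open import Data.Rational.Properties using (+-identityˡ; +-identityʳ)
  open import Data.Fin using (Fin; punchIn)
  import Data.Fin.Properties as FP
  open import Data.List using (List)
  open import Data.Vec using (Vec; lookup; removeAt)
  import Data.Vec.Properties as VP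
  open import Data.Product using (_,_)
  open import Data.Empty using (⊥-elim)
  open import Relation.Nullary using (yes; no)
  open import Relation.Binary.PropositionalEquality
  open ≡-Reasoning
  open PowerSeries
  open ListSums
  open Indicators
  open MatrixStatistics
  open MatrixEnumeration
  open ValidMatrices

  sinksIn : ∀ {N} → Vec Bool N → Mat N → Bool
  sinksIn {N} S a = ∧T N (λ k → if lookup S k then sinkᵇ a k else true)

  sinkWeight : ∀ {N} → Vec Bool N → Mat N → PS
  sinkWeight S a = ifP (sinksIn S a) (weight a)

  sinkSum : ∀ {N} → Vec Bool N → PS
  sinkSum {N} S = ΣL (allMatrices N) (λ M → sinkWeight S (entry M))

  allFalse : ∀ {n} → Vec Bool n → Bool
  allFalse {n} c = ∧T n (λ i → not (lookup c i))

  lookup-removeAt : ∀ {n} (S : Vec Bool (suc n)) v k → lookup S (punchIn v k) ≡ lookup (removeAt S v) k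
  lookup-removeAt S v k = trans (cong (λ X → lookup X (punchIn v k)) (sym (VP.insertAt-removeAt S v))) (VP.insertAt-punchIn (removeAt S v) v (lookup S v) k)

  ones-none : ∀ {n} (c : Vec Bool n) → (∀ i → lookup c i ≡ false) → ones c ≡ 0
  ones-none {n} c none = trans (ΣF.FT-cong n (λ i → cong b2n (none i))) (ΣF.FT-ε n)

  ones-allFalse : ∀ {n} (c : Vec Bool n) → allFalse c ≡ true → ones c ≡ 0
  ones-allFalse {n} c e = ones-none c (λ i → not-true (lookup c i) (∧T-true⇒ n _ e i))

  zeros+ones : ∀ {n} (S : Vec Bool n) → zeros S ℕ.+ ones S ≡ n
  zeros+ones {n} S = trans (sym (ΣF.FT-∙ n _ _)) (trans (ΣF.FT-cong n (λ i → not+id (lookup S i))) (count n))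
    where
    not+id : ∀ b → b2n (not b) ℕ.+ b2n b ≡ 1
    not+id true = refl
    not+id false = refl
    count : ∀ n → ΣT n (λ _ → 1) ≡ n
    count zero = refl
    count (suc n) = cong suc (count n)

  ones-remove : ∀ {n} (S : Vec Bool (suc n)) v → lookup S v ≡ true → ones S ≡ suc (ones (removeAt S v))
  ones-remove {n} S v Sv = trans (ΣF.FT-punch n v (λ i → b2n (lookup S i)))
    (cong₂ ℕ._+_ (cong b2n Sv) (ΣF.FT-cong n (λ k → cong b2n (lookup-removeAt S v k))))

  module Extend {n} (v : Fin (suc n)) (M : Matrix n) (r c : Vec Bool n) (d : Bool) where
    a : Mat (suc n)
    a = entry (extend v M r c d)

    minor-entries : ∀ i k → minor v a i k ≡ entry M i k
    minor-entries = extend-ik v M r c d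

    sink-v : sinkᵇ a v ≡ allFalse c
    sink-v = trans (sinkᵇ-v v a) (∧F.FT-cong n (λ i → cong not (extend-iv v M r c d i)))

    sink-k : ∀ k → sinkᵇ a (punchIn v k) ≡ not (lookup r k) ∧ sinkᵇ (entry M) k
    sink-k k = trans (sinkᵇ-punch v a k) (cong₂ _∧_ (cong not (extend-vk v M r c d k)) (sinkᵇ-cong minor-entries k))

    sinksIn-extend : ∀ S → lookup S v ≡ true → sinksIn S a ≡ allFalse c ∧ (avoids (removeAt S v) r ∧ sinksIn (removeAt S v) (entry M))
    sinksIn-extend S Sv = begin
      sinksIn S a ≡⟨ ∧F.FT-punch n v (λ k → if lookup S k then sinkᵇ a k else true) ⟩
      (if lookup S v then sinkᵇ a v else true) ∧ ∧T n (λ k → if lookup S (punchIn v k) then sinkᵇ a (punchIn v k) else true)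
        ≡⟨ cong₂ _∧_ (trans (cong (λ x → if x then sinkᵇ a v else true) Sv) sink-v)
                      (∧F.FT-cong n (λ k → trans (cong₂ (λ x y → if x then y else true) (lookup-removeAt S v k) (sink-k k))
                                                 (if-∧ (lookup S' k) (not (lookup r k)) (sinkᵇ (entry M) k)))) ⟩
      allFalse c ∧ ∧T n (λ k → (if lookup S' k then not (lookup r k) else true) ∧ (if lookup S' k then sinkᵇ (entry M) k else true))
        ≡⟨ cong (allFalse c ∧_) (∧F.FT-∙ n _ _) ⟩
      allFalse c ∧ (avoids S' r ∧ sinksIn S' (entry M)) ∎
      where
      S' : Vec Bool n
      S' = removeAt S v
      if-∧ : ∀ (s x y : Bool) → (if s then x ∧ y else true) ≡ (if s then x else true) ∧ (if s then y else true)
      if-∧ true x y = refl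
      if-∧ false x y = refl

    valid-extend : allFalse c ≡ true → valid a ≡ d ∧ valid (entry M)
    valid-extend e = trans (valid-punch v a (trans sink-v e)) (cong₂ _∧_ (extend-vv v M r c d) (valid-cong minor-entries))

    offT-extend : allFalse c ≡ true → offT a ≡ offT (entry M) ℕ.+ ones r
    offT-extend e = trans (offT-punch v a) (cong₂ ℕ._+_ (offT-cong minor-entries)
                    (trans (cong₂ ℕ._+_ (ΣF.FT-cong n (λ k → cong b2n (extend-vk v M r c d k)))
                                        (trans (ΣF.FT-cong n (λ i → cong b2n (extend-iv v M r c d i))) (ones-allFalse c e)))
                           (ℕP.+-identityʳ (ones r))))

  weight-split : ∀ x y d z o r → ifP (x ∧ y) (ifP (d ∧ z) (mono (o ℕ.+ r))) ≗ₚ ifP d (ifP x (mono r) ⊛ ifP y (ifP z (mono o)))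
  weight-split true true true true o r j = trans (mono-+ o r j) (⊛-comm (mono o) (mono r) j)
  weight-split true true true false o r j = sym (⊛-zero (mono r) j)
  weight-split true true false z o r j = refl
  weight-split true false true z o r j = sym (⊛-zero (mono r) j)
  weight-split true false false z o r j = refl
  weight-split false y true z o r j = sym (ifP-⊛ false (mono r) (ifP y (ifP z (mono o))) j)
  weight-split false y false z o r j = refl

  sinkWeight-extend : ∀ {n} (v : Fin (suc n)) (S : Vec Bool (suc n)) → lookup S v ≡ true → ∀ M r c d →
    sinkWeight S (entry (extend v M r c d)) ≗ₚ ifP (allFalse c) (ifP d (ifP (avoids (removeAt S v) r) (mono (ones r)) ⊛ sinkWeight (removeAt S v) (entry M)))
  sinkWeight-extend {n} v S Sv M r c d j with allFalse c in ec
  ... | false = cong (λ b → ifP b (weight (Extend.a v M r c d)) j) (trans (Extend.sinksIn-extend v M r c d S Sv) (cong (_∧ _) ec))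
  ... | true = begin
    ifP (sinksIn S a) (ifP (valid a) (mono (offT a))) j
      ≡⟨ cong₂ (λ b1 b2 → ifP b1 (ifP b2 (mono (offT a))) j) (trans (Extend.sinksIn-extend v M r c d S Sv) (cong (_∧ _) ec)) (Extend.valid-extend v M r c d ec) ⟩
    ifP (avoids S' r ∧ sinksIn S' (entry M)) (ifP (d ∧ valid (entry M)) (mono (offT a))) j
      ≡⟨ cong (λ o → ifP (avoids S' r ∧ sinksIn S' (entry M)) (ifP (d ∧ valid (entry M)) (mono o)) j) (Extend.offT-extend v M r c d ec) ⟩
    ifP (avoids S' r ∧ sinksIn S' (entry M)) (ifP (d ∧ valid (entry M)) (mono (offT (entry M) ℕ.+ ones r))) j
      ≡⟨ weight-split (avoids S' r) (sinksIn S' (entry M)) d (valid (entry M)) (offT (entry M)) (ones r) j ⟩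
    ifP d (ifP (avoids S' r) (mono (ones r)) ⊛ sinkWeight S' (entry M)) j ∎
    where
    a : Mat (suc n)
    a = Extend.a v M r c d
    S' : Vec Bool n
    S' = removeAt S v

  sum-diagonal : ∀ b X j → ΣQ bools (λ d → ifP b (ifP d X) j) ≡ ifP b X j
  sum-diagonal true X j = trans (cong (X j +_) (+-identityˡ 0ℚ)) (+-identityʳ (X j))
  sum-diagonal false X j = trans (+-identityˡ _) (+-identityˡ 0ℚ)

  sum-column : ∀ n X j → ΣQ (allVecs n bools) (λ c → ifP (allFalse c) X j) ≡ X j
  sum-column zero X j = +-identityʳ (X j)
  sum-column (suc n) X j = begin
    ΣQ (allVecs (suc n) bools) (λ c → ifP (allFalse c) X j) ≡⟨ ΣQ-vec n (λ c → ifP (allFalse c) X j) ⟩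
    ΣQ (allVecs n bools) (λ c → 0ℚ) + ΣQ (allVecs n bools) (λ c → ifP (allFalse c) X j) ≡⟨ cong₂ _+_ (ΣQ-0 (allVecs n bools)) (sum-column n X j) ⟩
    0ℚ + X j ≡⟨ +-identityˡ (X j) ⟩
    X j ∎

  sinkSum-remove : ∀ {n} (v : Fin (suc n)) (S : Vec Bool (suc n)) → lookup S v ≡ true →
    sinkSum S ≗ₚ ((P ^ₚ zeros (removeAt S v)) ⊛ sinkSum (removeAt S v))
  sinkSum-remove {n} v S Sv j = begin
    ΣQ (allMatrices (suc n)) (λ M → sinkWeight S (entry M) j)
      ≡⟨ ΣQ-extend n v (λ M → sinkWeight S (entry M) j) ⟩
    ΣQ (allMatrices n) (λ M → ΣQ rs (λ r → ΣQ rs (λ c → ΣQ bools (λ d → sinkWeight S (entry (extend v M r c d)) j))))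
      ≡⟨ ΣQ-cong (allMatrices n) (λ M → ΣQ-cong rs (λ r → ΣQ-cong rs (λ c →
           trans (ΣQ-cong bools (λ d → sinkWeight-extend v S Sv M r c d j)) (sum-diagonal (allFalse c) (Z M r) j)))) ⟩
    ΣQ (allMatrices n) (λ M → ΣQ rs (λ r → ΣQ rs (λ c → ifP (allFalse c) (Z M r) j)))
      ≡⟨ ΣQ-cong (allMatrices n) (λ M → ΣQ-cong rs (λ r → sum-column n (Z M r) j)) ⟩
    ΣQ (allMatrices n) (λ M → ΣQ rs (λ r → Z M r j))
      ≡⟨ ΣQ-cong (allMatrices n) (λ M → trans (sym (ΣL-⊛ rs row (sinkWeight S' (entry M)) j))
                                               (⊛-congˡ (sinkWeight S' (entry M)) (sum-avoiding n S') j)) ⟩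
    ΣQ (allMatrices n) (λ M → ((P ^ₚ zeros S') ⊛ sinkWeight S' (entry M)) j)
      ≡⟨ sym (ΣL-⊛ˡ (allMatrices n) (λ M → sinkWeight S' (entry M)) (P ^ₚ zeros S') j) ⟩
    ((P ^ₚ zeros S') ⊛ sinkSum S') j ∎
    where
    S' : Vec Bool n
    S' = removeAt S v
    rs : List (Vec Bool n)
    rs = allVecs n bools
    row : Vec Bool n → PS
    row r = ifP (avoids S' r) (mono (ones r))
    Z : Matrix n → Vec Bool n → PS
    Z M r = row r ⊛ sinkWeight S' (entry M)

  sinkSum-none : ∀ N (S : Vec Bool N) → (∀ v → lookup S v ≡ false) → sinkSum S ≗ₚ HPS N
  sinkSum-none N S none j = ΣQ-cong (allMatrices N) (λ M → cong (λ b → ifP b (weight (entry M)) j) (no-condition (entry M)))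
    where
    no-condition : ∀ a → sinksIn S a ≡ true
    no-condition a = ∧T-true⇐ N _ (λ k → cong (λ x → if x then sinkᵇ a k else true) (none k))

  sinkSum-closed : ∀ N (S : Vec Bool N) → sinkSum S ≗ₚ ((P ^ₚ (ones S ℕ.* (N ∸ ones S))) ⊛ HPS (N ∸ ones S))
  sinkSum-closed N S with FP.any? (λ v → lookup S v BP.≟ true)
  ... | no none = subst (λ k → sinkSum S ≗ₚ ((P ^ₚ (k ℕ.* (N ∸ k))) ⊛ HPS (N ∸ k))) (sym (ones-none S all-false))
                        (λ j → trans (sinkSum-none N S all-false j) (sym (⊛-identityˡ (HPS N) j)))
    where
    all-false : ∀ v → lookup S v ≡ false
    all-false v with lookup S v in e
    ... | true = ⊥-elim (none (v , e))
    ... | false = refl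
  sinkSum-closed (suc n) S | yes (v , Sv) =
    subst (λ k → sinkSum S ≗ₚ ((P ^ₚ (k ℕ.* (suc n ∸ k))) ⊛ HPS (suc n ∸ k))) (sym (ones-remove S v Sv)) step
    where
    S' : Vec Bool n
    S' = removeAt S v
    k m : ℕ
    k = ones S'
    m = n ∸ k
    zeros≡m : zeros S' ≡ m
    zeros≡m = trans (sym (ℕP.m+n∸n≡m (zeros S') k)) (cong (_∸ k) (zeros+ones S'))
    powers : ((P ^ₚ zeros S') ⊛ (P ^ₚ (k ℕ.* m))) ≗ₚ (P ^ₚ (m ℕ.+ k ℕ.* m))
    powers i = trans (sym (^ₚ-+ P (zeros S') (k ℕ.* m) i)) (cong (λ x → (P ^ₚ (x ℕ.+ k ℕ.* m)) i) zeros≡m)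
    step : sinkSum S ≗ₚ ((P ^ₚ (m ℕ.+ k ℕ.* m)) ⊛ HPS m)
    step j = begin
      sinkSum S j ≡⟨ sinkSum-remove v S Sv j ⟩
      ((P ^ₚ zeros S') ⊛ sinkSum S') j ≡⟨ ⊛-congʳ (P ^ₚ zeros S') (sinkSum-closed n S') j ⟩
      ((P ^ₚ zeros S') ⊛ ((P ^ₚ (k ℕ.* m)) ⊛ HPS m)) j ≡⟨ sym (⊛-assoc (P ^ₚ zeros S') (P ^ₚ (k ℕ.* m)) (HPS m) j) ⟩
      (((P ^ₚ zeros S') ⊛ (P ^ₚ (k ℕ.* m))) ⊛ HPS m) j ≡⟨ ⊛-congˡ (HPS m) powers j ⟩
      ((P ^ₚ (m ℕ.+ k ℕ.* m)) ⊛ HPS m) j ∎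

module InclusionExclusion where

  open import Data.Bool using (Bool; true; false; if_then_else_; _∧_; not; T)
  import Data.Bool.Properties as BP
  open import Data.Nat as ℕ using (zero; suc; _∸_)
  import Data.Nat.Properties as ℕP
  open import Data.Nat.Combinatorics using (_C_; nCk+nC[k+1]≡[n+1]C[k+1]; k>n⇒nCk≡0)
  open import Data.Rational using (ℚ; 0ℚ; 1ℚ; _+_; _*_; -_)
  open import Data.Rational.Properties
  open import Data.Fin as F using (Fin; punchIn)
  open import Data.List using (List)
  open import Data.Vec using (Vec; lookup)
  open import Data.Product using (proj₁; proj₂)
  open import Data.Unit using (tt)
  open import Function using (_∘_)
  open import Relation.Binary.PropositionalEquality
  open ≡-Reasoning
  open PowerSeries
  open NatToRational
  open Recurrence
  open ListSums
  open Indicators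
  open MatrixStatistics
  open IdentityOnly
  open SinkExistence
  open PermanentOne
  open ValidMatrices
  open SinkRemoval

  alternating-step : ∀ {X : Set} (xs : List X) (c : X → ℕ) (C : X → Bool) (R : Bool) (b : Bool) →
    ΣQ xs (λ S → sgn (c S) * b2q (C S)) ≡ b2q R →
    ΣQ xs (λ S → - sgn (c S) * b2q (b ∧ C S)) + ΣQ xs (λ S → sgn (c S) * b2q (C S)) ≡ b2q (not b ∧ R)
  alternating-step xs c C R true ih = begin
    ΣQ xs (λ S → - sgn (c S) * b2q (C S)) + Yq
      ≡⟨ cong (_+ Yq) (trans (ΣQ-cong xs (λ S → sym (neg-distribˡ-* (sgn (c S)) (b2q (C S))))) (ΣQ-neg xs (λ S → sgn (c S) * b2q (C S)))) ⟩
    - Yq + Yq ≡⟨ +-inverseˡ Yq ⟩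
    0ℚ ∎
    where
    Yq : ℚ
    Yq = ΣQ xs (λ S → sgn (c S) * b2q (C S))
  alternating-step xs c C R false ih = begin
    ΣQ xs (λ S → - sgn (c S) * 0ℚ) + Yq
      ≡⟨ cong (_+ Yq) (trans (ΣQ-cong xs (λ S → *-zeroʳ (- sgn (c S)))) (ΣQ-0 xs)) ⟩
    0ℚ + Yq ≡⟨ +-identityˡ Yq ⟩
    Yq ≡⟨ ih ⟩
    b2q R ∎
    where
    Yq : ℚ
    Yq = ΣQ xs (λ S → sgn (c S) * b2q (C S))

  alternating-sum : ∀ N (t : Fin N → Bool) → ΣQ (allVecs N bools) (λ S → sgn (ones S) * b2q (∧T N (λ k → if lookup S k then t k else true))) ≡ b2q (∧T N (λ k → not (t k)))
  alternating-sum zero t = trans (+-identityʳ (1ℚ * 1ℚ)) (*-identityˡ 1ℚ)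
  alternating-sum (suc N) t = trans (ΣQ-vec N (λ S → sgn (ones S) * b2q (∧T (suc N) (λ k → if lookup S k then t k else true))))
    (alternating-step (allVecs N bools) ones (λ S → ∧T N (λ k → if lookup S k then t (F.suc k) else true)) (∧T N (λ k → not (t (F.suc k)))) (t F.zero)
              (alternating-sum N (t ∘ F.suc)))

  ∧T-false : ∀ n (f : Fin (suc n) → Bool) v → f v ≡ false → ∧T (suc n) f ≡ false
  ∧T-false n f v e = trans (∧F.FT-punch n v f) (cong (_∧ ∧T n (f ∘ punchIn v)) e)

  -- A valid nonempty matrix has a sink, so "no vertex is a sink" kills its weight.
  no-sink-vanishes : ∀ {n} (a : Mat (suc n)) j → b2q (∧T (suc n) (λ k → not (sinkᵇ a k))) * weight a j ≡ 0ℚ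
  no-sink-vanishes {n} a j with valid a in ev
  ... | false = *-zeroʳ (b2q (∧T (suc n) (λ k → not (sinkᵇ a k))))
  ... | true = trans (cong (λ b → b2q b * mono (offT a) j) (∧T-false n (λ k → not (sinkᵇ a k)) v (cong not (Sink⇒sinkᵇ a v sk)))) (*-zeroˡ (mono (offT a) j))
    where
    dg : ∀ k → a k k ≡ true
    dg = diag⇒ a (BP.∧-conicalˡ (diagT a) _ ev)
    pe : per a ≡ 1
    pe = ℕP.≡ᵇ⇒≡ (per a) 1 (subst T (sym (BP.∧-conicalʳ (diagT a) _ ev)) tt)
    v : Fin (suc n)
    v = proj₁ (has-sink a dg (per≡1⇒OnlyIdentity a dg pe))
    sk : Sink a v
    sk = proj₂ (has-sink a dg (per≡1⇒OnlyIdentity a dg pe))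

  -- Σ_S (-1)^|S| sinkSum S = 0 for N ≥ 1: exchanging the sums, each matrix contributes
  -- its weight times [it has no sink], which vanishes.
  inclusion-exclusion : ∀ n j → ΣQ (allVecs (suc n) bools) (λ S → sgn (ones S) * sinkSum S j) ≡ 0ℚ
  inclusion-exclusion n j = begin
    ΣQ Ss (λ S → sgn (ones S) * ΣQ Ms (λ M → sinkWeight S (entry M) j))
      ≡⟨ ΣQ-cong Ss (λ S → sym (ΣQ-*ˡ Ms (sgn (ones S)) (λ M → sinkWeight S (entry M) j))) ⟩
    ΣQ Ss (λ S → ΣQ Ms (λ M → sgn (ones S) * sinkWeight S (entry M) j))
      ≡⟨ ΣQ-swap Ss Ms (λ S M → sgn (ones S) * sinkWeight S (entry M) j) ⟩
    ΣQ Ms (λ M → ΣQ Ss (λ S → sgn (ones S) * sinkWeight S (entry M) j))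
      ≡⟨ ΣQ-cong Ms (λ M → trans (ΣQ-cong Ss (λ S → trans (cong (sgn (ones S) *_) (ifP-mult (sinksIn S (entry M)) (weight (entry M)) j))
                                                            (sym (*-assoc (sgn (ones S)) (b2q (sinksIn S (entry M))) (weight (entry M) j)))))
                            (trans (ΣQ-*ʳ Ss (weight (entry M) j) (λ S → sgn (ones S) * b2q (sinksIn S (entry M))))
                            (trans (cong (_* weight (entry M) j) (alternating-sum (suc n) (sinkᵇ (entry M)))) (no-sink-vanishes (entry M) j)))) ⟩
    ΣQ Ms (λ M → 0ℚ) ≡⟨ ΣQ-0 Ms ⟩
    0ℚ ∎
    where
    Ss : List (Vec Bool (suc n))
    Ss = allVecs (suc n) bools
    Ms : List (Matrix (suc n))
    Ms = allMatrices (suc n)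

  sum-by-size : ∀ N (G : ℕ → ℚ) → ΣQ (allVecs N bools) (λ S → G (ones S)) ≡ sumUpTo N (λ s → ℕtoℚ (N C s) * G s)
  sum-by-size zero G = trans (+-identityʳ (G 0)) (sym (*-identityˡ (G 0)))
  sum-by-size (suc N) G = begin
    ΣQ (allVecs (suc N) bools) (λ S → G (ones S)) ≡⟨ ΣQ-vec N (λ S → G (ones S)) ⟩
    ΣQ (allVecs N bools) (λ S → G (suc (ones S))) + ΣQ (allVecs N bools) (λ S → G (ones S))
      ≡⟨ cong₂ _+_ (sum-by-size N (G ∘ suc)) (sum-by-size N G) ⟩
    containing + sumUpTo N h ≡⟨ cong (containing +_) avoiding-shift ⟩
    containing + (G 0 + avoiding) ≡⟨ sym (+-assoc containing (G 0) avoiding) ⟩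
    (containing + G 0) + avoiding ≡⟨ cong (_+ avoiding) (+-comm containing (G 0)) ⟩
    (G 0 + containing) + avoiding ≡⟨ +-assoc (G 0) containing avoiding ⟩
    G 0 + (containing + avoiding) ≡⟨ cong₂ _+_ (sym (*-identityˡ (G 0))) (sym (sumUpTo-+ N _ _)) ⟩
    1ℚ * G 0 + sumUpTo N (λ s → ℕtoℚ (N C s) * G (suc s) + ℕtoℚ (N C suc s) * G (suc s))
      ≡⟨ cong (1ℚ * G 0 +_) (sumUpTo-cong N (λ s _ → trans (sym (*-distribʳ-+ (G (suc s)) (ℕtoℚ (N C s)) (ℕtoℚ (N C suc s))))
                                           (cong (_* G (suc s)) (trans (sym (ℕtoℚ-+ (N C s) (N C suc s))) (cong ℕtoℚ (nCk+nC[k+1]≡[n+1]C[k+1] N s)))))) ⟩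
    1ℚ * G 0 + sumUpTo N (λ s → ℕtoℚ (suc N C suc s) * G (suc s))
      ≡⟨ sym (sumUpTo-shift N (λ s → ℕtoℚ (suc N C s) * G s)) ⟩
    sumUpTo (suc N) (λ s → ℕtoℚ (suc N C s) * G s) ∎
    where
    h : ℕ → ℚ
    h s = ℕtoℚ (N C s) * G s
    containing avoiding : ℚ
    containing = sumUpTo N (λ s → ℕtoℚ (N C s) * G (suc s))
    avoiding = sumUpTo N (λ s → ℕtoℚ (N C suc s) * G (suc s))
    avoiding-shift : sumUpTo N h ≡ G 0 + avoiding
    avoiding-shift = begin
      sumUpTo N h ≡⟨ sym (+-identityʳ (sumUpTo N h)) ⟩
      sumUpTo N h + 0ℚ ≡⟨ cong (sumUpTo N h +_) (sym (trans (cong (λ x → ℕtoℚ x * G (suc N)) (k>n⇒nCk≡0 (ℕP.n<1+n N))) (*-zeroˡ (G (suc N))))) ⟩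
      sumUpTo (suc N) h ≡⟨ sumUpTo-shift N h ⟩
      h 0 + avoiding ≡⟨ cong (_+ avoiding) (*-identityˡ (G 0)) ⟩
      G 0 + avoiding ∎

  HPS-rec : ∀ n → Rec HPS (suc n)
  HPS-rec n j = begin
    ΣP N (RecTerm HPS N) j
      ≡⟨ sumUpTo-cong N (λ s _ → rearr (sgn s) (ℕtoℚ (N C s)) (((P ^ₚ (s ℕ.* (N ∸ s))) ⊛ HPS (N ∸ s)) j)) ⟩
    sumUpTo N (λ s → ℕtoℚ (N C s) * G s) ≡⟨ sym (sum-by-size N G) ⟩
    ΣQ (allVecs N bools) (λ S → G (ones S)) ≡⟨ ΣQ-cong (allVecs N bools) (λ S → cong (sgn (ones S) *_) (sym (sinkSum-closed N S j))) ⟩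
    ΣQ (allVecs N bools) (λ S → sgn (ones S) * sinkSum S j) ≡⟨ inclusion-exclusion n j ⟩
    0ℚ ∎
    where
    N : ℕ
    N = suc n
    G : ℕ → ℚ
    G s = sgn s * ((P ^ₚ (s ℕ.* (N ∸ s))) ⊛ HPS (N ∸ s)) j
    rearr : ∀ x y z → (x * y) * z ≡ y * (x * z)
    rearr x y z = trans (cong (_* z) (*-comm x y)) (*-assoc y x z)

-- Both families satisfy the recurrence and start with 1, hence coincide.
-- (The argument does not need the hypothesis 1 ≤ n: for n = 0 both sides are [e = 0].)
proposition4 : (n : ℕ) → 1 ≤ n → (e : ℕ) → ℕtoℚ (H n e) ≡ taylorCoeff (Y n) e
proposition4 n _ e = trans (H≡HPS n e) (Rec-unique HPS Y same-start HPS-rec Y-rec n e)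
  where
  open PowerSeries using (_≗ₚ_)
  open Recurrence using (Rec-unique)
  open AnalyticSide using (Y-rec; Y0)
  open ValidMatrices using (HPS; H≡HPS; HPS-zero)
  open InclusionExclusion using (HPS-rec)
  same-start : HPS 0 ≗ₚ Y 0
  same-start j = trans (HPS-zero j) (sym (Y0 j))
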